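{- Let $q$ be an odd prime power with $q \equiv 3 \pmod 4$ and let $\Omega = F_q^2$. Partition $\Omega \times \Omega$ into the $q$ subsets $C_i$, $i \in F_q$, where $(X, Y) \in C_i$ if and only if $Q(X, Y) = i$. This partition is an association scheme on $F_q^2$. Moreover, writing $f(i,j,k) = ij - (k - i - j)^2/4$ for $i, j, k \in F_q$, its intersection numbers are $$p_{ij}^0 = \begin{cases} 0 & \text{if } i \neq j,\\ 1 & \text{if } i = j = 0,\\ q+1 & \text{if } i = j \neq 0,\end{cases}$$ and, for $k \neq 0$, $$p_{ij}^k = \begin{cases} 0 & \text{if } f(i,j,k) \text{ is a non-square in } F_q,\\ 1 & \text{if } f(i,j,k) = 0,\\ 2 & \text{if } f(i,j,k) \text{ is a nonzero square in } F_q.\end{cases}$$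
   Context: $F_q$ is the finite field with $q$ elements. The quadrance of $A_1 = [x_1,y_1]$, $A_2 = [x_2,y_2] \in F_q^2$ is $Q(A_1,A_2) = (x_2-x_1)^2 + (y_2-y_1)^2$. An association scheme on a finite set $\Omega$ is a partition of $\Omega \times \Omega$ into sets $C_0, C_1, \ldots, C_s$ such that (i) $C_0 = \{(\omega,\omega) : \omega \in \Omega\}$; (ii) each $C_i$ is symmetric, i.e. $(\alpha,\beta) \in C_i$ implies $(\beta,\alpha) \in C_i$; (iii) for all indices $i,j,k$ there is an integer $p_{ij}^k$ such that for every $(\alpha,\beta) \in C_k$, $|\{\gamma \in \Omega : (\alpha,\gamma) \in C_i, (\gamma,\beta) \in C_j\}| = p_{ij}^k$. Here the classes are indexed by elements of $F_q$, with $C_0$ the class of quadrance $0$. -}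

module Defs where

open import Level using (Level; _⊔_) renaming (suc to lsuc)
open import Algebra.Bundles using (CommutativeRing)
open import Data.Nat as ℕ using (ℕ; zero; suc)
open import Data.Fin using (Fin; zero; suc)
open import Data.Product using (Σ; _×_; _,_; ∃; ∃-syntax)
open import Relation.Nullary using (¬_; Dec; does)
open import Relation.Binary using (Decidable)
open import Relation.Binary.PropositionalEquality using (_≡_)
open import Data.Bool using (if_then_else_)
open import Relation.Nullary.Decidable using (_×-dec_)
open import Function.Bundles using (_⇔_)

countFin : ∀ {p} {n : ℕ} (P : Fin n → Set p) → (∀ x → Dec (P x)) → ℕ
countFin {n = zero}  P P? = 0
countFin {n = suc n} P P? =
  (if does (P? zero) then 1 else 0) ℕ.+ countFin (λ x → P (suc x)) (λ x → P? (suc x))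

sumFin : {n : ℕ} → (Fin n → ℕ) → ℕ
sumFin {zero}  f = 0
sumFin {suc n} f = f zero ℕ.+ sumFin (λ x → f (suc x))

record FiniteField (c ℓ : Level) : Set (lsuc (c ⊔ ℓ)) where
  field
    cring : CommutativeRing c ℓ
  open CommutativeRing cring public
  field
    _≟_       : Decidable _≈_
    1≉0       : ¬ (1# ≈ 0#)
    inverse   : ∀ x → ¬ (x ≈ 0#) → ∃[ y ] (x * y ≈ 1#)
    size      : ℕ
    enum      : Fin size → Carrier
    enum-surj : ∀ x → ∃[ m ] (enum m ≈ x)
    enum-inj  : ∀ m n → enum m ≈ enum n → m ≡ n

module _ {c ℓ : Level} (F : FiniteField c ℓ) where
  open FiniteField F

  Point : Set c
  Point = Carrier × Carrier

  _≈ₚ_ : Point → Point → Set ℓ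
  (x₁ , y₁) ≈ₚ (x₂ , y₂) = (x₁ ≈ x₂) × (y₁ ≈ y₂)

  quadrance : Point → Point → Carrier
  quadrance (x₁ , y₁) (x₂ , y₂) =
    ((x₂ - x₁) * (x₂ - x₁)) + ((y₂ - y₁) * (y₂ - y₁))

  InClass : Carrier → Point → Point → Set ℓ
  InClass i X Y = quadrance X Y ≈ i

  IsSquare : Carrier → Set (c ⊔ ℓ)
  IsSquare x = ∃[ y ] (y * y ≈ x)

  -- |{γ ∈ F_q^2 : (α,γ) ∈ C_i, (γ,β) ∈ C_j}|, counted via the enumeration
  -- Fin q × Fin q ≅ F_q^2.
  Between : Carrier → Carrier → Point → Point → Point → Set ℓ
  Between i j α β γ = InClass i α γ × InClass j γ β

  Between? : ∀ i j α β γ → Dec (Between i j α β γ)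
  Between? i j α β γ = quadrance α γ ≟ i ×-dec quadrance γ β ≟ j

  interCount : Carrier → Carrier → Point → Point → ℕ
  interCount i j α β =
    sumFin (λ a → countFin (λ b → Between i j α β (enum a , enum b))
                           (λ b → Between? i j α β (enum a , enum b)))

  -- the association scheme axioms (i)-(iii) for the partition {C_i}_{i ∈ F_q}
  -- of F_q^2 × F_q^2 (classes indexed by elements of F_q, C_0 = quadrance 0)
  record IsQuadranceScheme : Set (c ⊔ ℓ) where
    field
      diagonal   : ∀ X Y → InClass 0# X Y ⇔ (X ≈ₚ Y)
      symmetric  : ∀ i X Y → InClass i X Y → InClass i Y X
      intersection : Σ (Carrier → Carrier → Carrier → ℕ) λ p → (∀ i j k α β → InClass k α β →
                                interCount i j α β ≡ p i j k)

  -- f(i,j,k) = ij - (k - i - j)²/4, where `quarter` stands for 1/4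
  fijk : Carrier → Carrier → Carrier → Carrier → Carrier
  fijk quarter i j k = (i * j) - (((k - i - j) * (k - i - j)) * quarter)

  four : Carrier
  four = 1# + 1# + 1# + 1#

  -- the stated values of the intersection numbers p_{ij}^k, where for
  -- (α,β) ∈ C_k the number p_{ij}^k is interCount i j α β
  record HasIntersectionNumbers (quarter : Carrier) : Set (c ⊔ ℓ) where
    field
      p0-ne       : ∀ i j α β → InClass 0# α β → ¬ (i ≈ j) →
                      interCount i j α β ≡ 0
      p0-zero     : ∀ i j α β → InClass 0# α β → i ≈ 0# → j ≈ 0# →
                      interCount i j α β ≡ 1
      p0-nonzero  : ∀ i j α β → InClass 0# α β → i ≈ j → ¬ (i ≈ 0#) →
                      interCount i j α β ≡ size ℕ.+ 1
      pk-nonsq    : ∀ i j k α β → InClass k α β → ¬ (k ≈ 0#) →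
                      ¬ IsSquare (fijk quarter i j k) →
                      interCount i j α β ≡ 0
      pk-zero     : ∀ i j k α β → InClass k α β → ¬ (k ≈ 0#) →
                      fijk quarter i j k ≈ 0# →
                      interCount i j α β ≡ 1
      pk-sq       : ∀ i j k α β → InClass k α β → ¬ (k ≈ 0#) →
                      ¬ (fijk quarter i j k ≈ 0#) → IsSquare (fijk quarter i j k) →
                      interCount i j α β ≡ 2

{-# OPTIONS --safe #-}
-- For k ≠ 0 write u = β − α.  By the law of cosines every γ with Q(α,γ) = i and Q(γ,β) = j has
-- ⟨γ − α, u⟩ = (i + k − j)/2, and by Lagrange's identity its other coordinate b = (γ − α) ∧ u then
-- satisfies b² = ik − (i + k − j)²/4 = f(i,j,k).  Conversely every root b gives back exactly one such γ,
-- so p_ij^k is the number of square roots of f(i,j,k).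
-- Since q ≡ 3 (mod 4), −1 is not a square, so x² + y² = 0 only at the origin (axiom (i), and α = β
-- when k = 0), and F² is the field F(√−1) with norm x² + y².  For k = 0 and i ≠ 0, p_ii^0 is the size
-- of a circle of radius i.  Multiplying by a point of norm i maps the unit circle onto it, so all
-- nonzero radii give circles of the same size c, and q² − 1 = (q − 1)c yields c = q + 1.
module Submission where

open import Defs
open import Level using (Level; _⊔_) renaming (suc to lsuc)
open import Algebra.Bundles using (CommutativeRing)
open import Data.Nat as ℕ using (ℕ; zero; suc; _%_)
import Data.Nat.Properties as ℕₚ
open import Data.Nat.DivMod using (m*n%n≡0; [m+kn]%n≡m%n; m∣n⇒o%n%m≡o%m)
open import Data.Nat.Divisibility using (divides)
open import Data.Integer as ℤ using (ℤ; +_; -[1+_]; sign; ∣_∣; _◃_)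
import Data.Integer.Properties as ℤₚ
open import Data.Sign as Sign using (Sign)
open import Data.Maybe using (Maybe)
open import Data.Fin using (Fin; zero; suc)
import Data.Fin.Properties as Fin
open import Data.List using (List; []; _∷_; _++_; map; length; tabulate; cartesianProduct)
open import Data.List.Properties using (length-tabulate)
open import Data.Product using (_×_; _,_; proj₁; proj₂; ∃)
open import Data.Product.Relation.Binary.Pointwise.NonDependent using (×-decSetoid)
open import Data.Sum using (_⊎_; inj₁; inj₂; [_,_]′)
import Data.Sum
open import Function using (_∘_; id)
open import Function.Bundles using (mk⇔)
open import Function.Definitions using (Congruent)
open import Relation.Nullary using (¬_; Dec; yes; no; contradiction)
open import Relation.Nullary.Decidable using (dec⇒maybe; decidable-stable)
open import Relation.Unary using (Pred; U; Decidable; Empty; Universal; Satisfiable; _⊆_; _≐_; _∩_; ∁)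
open import Relation.Unary.Properties using (U?; _∩?_; ∁?; _×?_)
open import Relation.Binary using (DecSetoid; _Respects_)
open import Relation.Binary.PropositionalEquality as ≡ using (_≡_; _≢_)
import Algebra.Solver.Ring
import Algebra.Solver.Ring.AlmostCommutativeRing as ACR
import Algebra.Solver.Ring.NaturalCoefficients.Default as ℕ-Coefficients
import Relation.Binary.Reasoning.Setoid

-- The library's solvers for an abstract ring take the carrier itself as coefficient ring, where
-- constants such as 1# + 1# do not normalise and the final `refl` fails; so coefficients are taken
-- in ℤ instead.  ⟦_⟧ℤ uses the TCOptimised multiple, for which 1 · x = x holds definitionally, so
-- con (+ 4) is literally four F.
module ℤ-CoefficientSolver {c ℓ} (R : CommutativeRing c ℓ) where
  open CommutativeRing R
  open import Algebra.Properties.Ring ring using (-‿involutive; -0#≈0#; -1*x≈-x; -‿+-comm)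
  open import Algebra.Properties.Semiring.Mult.TCOptimised semiring
    using (1+×; ×-homo-+; ×1-homo-*) renaming (_×_ to _·_)
  open import Relation.Binary.Reasoning.Setoid setoid

  ⟦_⟧ℤ : ℤ → Carrier
  ⟦ + n ⟧ℤ      = n · 1#
  ⟦ -[1+ n ] ⟧ℤ = - (suc n · 1#)

  private
    cancel-sum : ∀ x a b → (x + a) - (x + b) ≈ a - b
    cancel-sum x a b = begin
      (x + a) + - (x + b)    ≈⟨ +-congˡ (-‿+-comm x b) ⟨
      (x + a) + (- x + - b)  ≈⟨ N.solve 4 (λ x a x′ b′ → (x :+ a) :+ (x′ :+ b′) := (x :+ x′) :+ (a :+ b′))
                                          refl x a (- x) (- b) ⟩
      (x - x) + (a - b)      ≈⟨ +-congʳ (-‿inverseʳ x) ⟩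
      0# + (a - b)           ≈⟨ +-identityˡ _ ⟩
      a - b                  ∎
      where open module N = ℕ-Coefficients commutativeSemiring using (_:+_; _:=_)

  ⊖-homo : ∀ m n → ⟦ m ℤ.⊖ n ⟧ℤ ≈ m · 1# - n · 1#
  ⊖-homo zero    zero    = sym (-‿inverseʳ 0#)
  ⊖-homo (suc m) zero    = sym (trans (+-congˡ -0#≈0#) (+-identityʳ _))
  ⊖-homo zero    (suc n) = sym (+-identityˡ _)
  ⊖-homo (suc m) (suc n) rewrite ℤₚ.[1+m]⊖[1+n]≡m⊖n m n = trans (⊖-homo m n)
    (sym (trans (+-cong (1+× m 1#) (-‿cong (1+× n 1#))) (cancel-sum 1# (m · 1#) (n · 1#))))

  +-homo : ∀ i j → ⟦ i ℤ.+ j ⟧ℤ ≈ ⟦ i ⟧ℤ + ⟦ j ⟧ℤ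
  +-homo -[1+ m ] -[1+ n ] = begin
    - (suc (suc (m ℕ.+ n)) · 1#)  ≡⟨ ≡.cong (λ k → - (k · 1#)) (≡.cong suc (ℕₚ.+-suc m n)) ⟨
    - ((suc m ℕ.+ suc n) · 1#)    ≈⟨ -‿cong (×-homo-+ 1# (suc m) (suc n)) ⟩
    - (suc m · 1# + suc n · 1#)   ≈⟨ -‿+-comm _ _ ⟨
    ⟦ -[1+ m ] ⟧ℤ + ⟦ -[1+ n ] ⟧ℤ  ∎
  +-homo -[1+ m ] (+ n)    = trans (⊖-homo n (suc m)) (+-comm _ _)
  +-homo (+ m)    -[1+ n ] = ⊖-homo m (suc n)
  +-homo (+ m)    (+ n)    = ×-homo-+ 1# m n

  -‿homo : ∀ i → ⟦ ℤ.- i ⟧ℤ ≈ - ⟦ i ⟧ℤ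
  -‿homo -[1+ n ]    = sym (-‿involutive _)
  -‿homo (+ zero)    = sym -0#≈0#
  -‿homo (+ (suc n)) = refl

  private
    ⟦_⟧± : Sign → Carrier
    ⟦ Sign.+ ⟧± = 1#
    ⟦ Sign.- ⟧± = - 1#

    ±-homo : ∀ s t → ⟦ s Sign.* t ⟧± ≈ ⟦ s ⟧± * ⟦ t ⟧±
    ±-homo Sign.+ t      = sym (*-identityˡ _)
    ±-homo Sign.- Sign.+ = sym (*-identityʳ _)
    ±-homo Sign.- Sign.- = sym (trans (-1*x≈-x _) (-‿involutive _))

    ◃-homo : ∀ s n → ⟦ s ◃ n ⟧ℤ ≈ ⟦ s ⟧± * n · 1#
    ◃-homo s      zero    = sym (zeroʳ _)
    ◃-homo Sign.+ (suc n) = sym (*-identityˡ _)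
    ◃-homo Sign.- (suc n) = sym (-1*x≈-x _)

    sign-abs : ∀ i → ⟦ i ⟧ℤ ≈ ⟦ sign i ⟧± * ∣ i ∣ · 1#
    sign-abs i = trans (≡.subst (λ j → ⟦ i ⟧ℤ ≈ ⟦ j ⟧ℤ) (≡.sym (ℤₚ.◃-inverse i)) refl) (◃-homo (sign i) ∣ i ∣)

  *-homo : ∀ i j → ⟦ i ℤ.* j ⟧ℤ ≈ ⟦ i ⟧ℤ * ⟦ j ⟧ℤ
  *-homo i j = begin
    ⟦ (s Sign.* t) ◃ (m ℕ.* n) ⟧ℤ          ≈⟨ ◃-homo (s Sign.* t) (m ℕ.* n) ⟩
    ⟦ s Sign.* t ⟧± * (m ℕ.* n) · 1#      ≈⟨ *-cong (±-homo s t) (×1-homo-* m n) ⟩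
    (⟦ s ⟧± * ⟦ t ⟧±) * (m · 1# * n · 1#)  ≈⟨ N.solve 4 (λ a b x y → (a :* b) :* (x :* y) := (a :* x) :* (b :* y))
                                                       refl ⟦ s ⟧± ⟦ t ⟧± (m · 1#) (n · 1#) ⟩
    (⟦ s ⟧± * m · 1#) * (⟦ t ⟧± * n · 1#)  ≈⟨ *-cong (sign-abs i) (sign-abs j) ⟨
    ⟦ i ⟧ℤ * ⟦ j ⟧ℤ                        ∎
    where
    open module N = ℕ-Coefficients commutativeSemiring using (_:*_; _:=_)
    s t : Sign
    s = sign i
    t = sign j
    m n : ℕ
    m = ∣ i ∣
    n = ∣ j ∣

  private
    almostCommutativeRing : ACR.AlmostCommutativeRing c ℓ
    almostCommutativeRing = ACR.fromCommutativeRing R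

    ⟦⟧ℤ-morphism : ℤ.+-*-rawRing ACR.-Raw-AlmostCommutative⟶ almostCommutativeRing
    ⟦⟧ℤ-morphism = record
      { ⟦_⟧ = ⟦_⟧ℤ ; +-homo = +-homo ; *-homo = *-homo ; -‿homo = -‿homo
      ; 0-homo = refl ; 1-homo = refl }

    ⟦⟧ℤ-≟ : ∀ i j → Maybe (⟦ i ⟧ℤ ≈ ⟦ j ⟧ℤ)
    ⟦⟧ℤ-≟ i j = Data.Maybe.map (λ i≡j → reflexive (≡.cong ⟦_⟧ℤ i≡j)) (dec⇒maybe (i ℤ.≟ j))

  open Algebra.Solver.Ring ℤ.+-*-rawRing almostCommutativeRing ⟦⟧ℤ-morphism ⟦⟧ℤ-≟ public

private variable
  a b p q ℓ₁ ℓ₂ : Level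
  A : Set a
  B : Set b

count : {P : Pred A p} → Decidable P → List A → ℕ
count P? []       = 0
count P? (x ∷ xs) with P? x
... | yes _ = suc (count P? xs)
... | no  _ = count P? xs

module _ {P : Pred A p} (P? : Decidable P) where

  count-none : Empty P → ∀ xs → count P? xs ≡ 0
  count-none ∅ []       = ≡.refl
  count-none ∅ (x ∷ xs) with P? x
  ... | yes px = contradiction px (∅ x)
  ... | no  _  = count-none ∅ xs

  count-all : Universal P → ∀ xs → count P? xs ≡ length xs
  count-all U []       = ≡.refl
  count-all U (x ∷ xs) with P? x
  ... | yes _   = ≡.cong suc (count-all U xs)
  ... | no  ¬px = contradiction (U x) ¬px

  count-witness : ∀ xs → count P? xs ≢ 0 → Satisfiable P
  count-witness []       #≢0 = contradiction ≡.refl #≢0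
  count-witness (x ∷ xs) #≢0 with P? x
  ... | yes px = x , px
  ... | no  _  = count-witness xs #≢0

  count-++ : ∀ xs ys → count P? (xs ++ ys) ≡ count P? xs ℕ.+ count P? ys
  count-++ []       ys = ≡.refl
  count-++ (x ∷ xs) ys with P? x
  ... | yes _ = ≡.cong suc (count-++ xs ys)
  ... | no  _ = count-++ xs ys

  count-map : (f : B → A) → ∀ xs → count P? (map f xs) ≡ count (P? ∘ f) xs
  count-map f []       = ≡.refl
  count-map f (x ∷ xs) with P? (f x)
  ... | yes _ = ≡.cong suc (count-map f xs)
  ... | no  _ = count-map f xs

  count-tabulate : ∀ {n} (g : Fin n → A) → count P? (tabulate g) ≡ countFin (P ∘ g) (P? ∘ g)
  count-tabulate {n = zero}  g = ≡.refl
  count-tabulate {n = suc n} g with P? (g zero)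
  ... | yes _ = ≡.cong suc (count-tabulate (g ∘ suc))
  ... | no  _ = count-tabulate (g ∘ suc)

module _ {P : Pred A p} {Q : Pred A q} (P? : Decidable P) (Q? : Decidable Q) where

  count-cong : P ≐ Q → ∀ xs → count P? xs ≡ count Q? xs
  count-cong P≐Q       []       = ≡.refl
  count-cong P≐Q@(P⊆Q , Q⊆P) (x ∷ xs) with P? x | Q? x
  ... | yes _   | yes _   = ≡.cong suc (count-cong P≐Q xs)
  ... | yes px  | no  ¬qx = contradiction (P⊆Q px) ¬qx
  ... | no  ¬px | yes qx  = contradiction (Q⊆P qx) ¬px
  ... | no  _   | no  _   = count-cong P≐Q xs

  count-split : ∀ xs → count P? xs ≡ count (P? ∩? Q?) xs ℕ.+ count (P? ∩? ∁? Q?) xs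
  count-split []       = ≡.refl
  count-split (x ∷ xs) with P? x | Q? x
  ... | yes _ | yes _ = ≡.cong suc (count-split xs)
  ... | yes _ | no  _ = ≡.trans (≡.cong suc (count-split xs)) (≡.sym (ℕₚ.+-suc _ _))
  ... | no  _ | yes _ = count-split xs
  ... | no  _ | no  _ = count-split xs

private
  first-row : {P : Pred A p} {Q : Pred B q} (P? : Decidable P) (Q? : Decidable Q) → ∀ x xs ys →
    count (P? ×? Q?) (cartesianProduct (x ∷ xs) ys) ≡
    count ((P? ×? Q?) ∘ (x ,_)) ys ℕ.+ count (P? ×? Q?) (cartesianProduct xs ys)
  first-row P? Q? x xs ys =
    ≡.trans (count-++ (P? ×? Q?) (map (x ,_) ys) _) (≡.cong (ℕ._+ _) (count-map (P? ×? Q?) (x ,_) ys))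

count-cartesianProduct : {P : Pred A p} {Q : Pred B q} (P? : Decidable P) (Q? : Decidable Q) →
  ∀ xs ys → count (P? ×? Q?) (cartesianProduct xs ys) ≡ count P? xs ℕ.* count Q? ys
count-cartesianProduct P? Q? []       ys = ≡.refl
count-cartesianProduct P? Q? (x ∷ xs) ys with P? x
... | yes px  = ≡.trans (first-row P? Q? x xs ys)
  (≡.cong₂ ℕ._+_ (count-cong _ Q? (proj₂ , (px ,_)) ys) (count-cartesianProduct P? Q? xs ys))
... | no  ¬px = ≡.trans (first-row P? Q? x xs ys)
  (≡.cong₂ ℕ._+_ (count-none _ (λ _ → ¬px ∘ proj₁) ys) (count-cartesianProduct P? Q? xs ys))

count-cartesianProduct-tabulate : ∀ {m n} {P : Pred (A × B) p} (P? : Decidable P)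
  (g : Fin m → A) (h : Fin n → B) →
  count P? (cartesianProduct (tabulate g) (tabulate h)) ≡
  sumFin (λ i → countFin (λ j → P (g i , h j)) (λ j → P? (g i , h j)))
count-cartesianProduct-tabulate {m = zero}  P? g h = ≡.refl
count-cartesianProduct-tabulate {m = suc m} {P = P} P? g h = begin
  count P? (map (g zero ,_) (tabulate h) ++ cartesianProduct (tabulate (g ∘ suc)) (tabulate h))
    ≡⟨ count-++ P? (map (g zero ,_) (tabulate h)) _ ⟩
  count P? (map (g zero ,_) (tabulate h)) ℕ.+ count P? (cartesianProduct (tabulate (g ∘ suc)) (tabulate h))
    ≡⟨ ≡.cong₂ ℕ._+_ (≡.trans (count-map P? (g zero ,_) (tabulate h)) (count-tabulate _ h))
                     (count-cartesianProduct-tabulate P? (g ∘ suc) h) ⟩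
  sumFin (λ i → countFin (λ j → P (g i , h j)) (λ j → P? (g i , h j)))
    ∎
  where open ≡.≡-Reasoning

countFin-none : ∀ {n} {P : Pred (Fin n) p} (P? : Decidable P) → Empty P → countFin P P? ≡ 0
countFin-none {n = zero}  P? ∅ = ≡.refl
countFin-none {n = suc n} P? ∅ with P? zero
... | yes p0 = contradiction p0 (∅ zero)
... | no  _  = countFin-none (P? ∘ suc) (∅ ∘ suc)

countFin-unique : ∀ {n} {P : Pred (Fin n) p} (P? : Decidable P) (m₀ : Fin n) →
  P m₀ → (∀ {m} → P m → m ≡ m₀) → countFin P P? ≡ 1
countFin-unique P? zero p₀ unique with P? zero
... | yes _  = ≡.cong suc (countFin-none (P? ∘ suc) (λ _ pm → Fin.0≢1+n (≡.sym (unique pm))))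
... | no ¬p₀ = contradiction p₀ ¬p₀
countFin-unique P? (suc m₀) p₀ unique with P? zero
... | yes p0 = contradiction (unique p0) Fin.0≢1+n
... | no  _  = countFin-unique (P? ∘ suc) m₀ p₀ (Fin.suc-injective ∘ unique)


record FiniteDecSetoid a ℓ : Set (lsuc (a ⊔ ℓ)) where
  field
    decSetoid : DecSetoid a ℓ
  open DecSetoid decSetoid public
  field
    elements    : List Carrier
    occurs-once : ∀ x → count (_≟ x) elements ≡ 1

  #_ : {P : Pred Carrier p} → Decidable P → ℕ
  # P? = count P? elements

_×-finite_ : FiniteDecSetoid a ℓ₁ → FiniteDecSetoid b ℓ₂ → FiniteDecSetoid (a ⊔ b) (ℓ₁ ⊔ ℓ₂)
S ×-finite T = record
  { decSetoid   = ×-decSetoid S.decSetoid T.decSetoid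
  ; elements    = cartesianProduct S.elements T.elements
  ; occurs-once = λ (x , y) → ≡.trans (count-cartesianProduct (S._≟ x) (T._≟ y) S.elements T.elements)
                                      (≡.cong₂ ℕ._*_ (S.occurs-once x) (T.occurs-once y))
  }
  where
  module S = FiniteDecSetoid S
  module T = FiniteDecSetoid T

module FiniteDecSetoidProperties (S : FiniteDecSetoid a ℓ₁) where
  open FiniteDecSetoid S

  module _ {P : Pred Carrier p} (P? : Decidable P) where

    #-none : Empty P → # P? ≡ 0
    #-none ∅ = count-none P? ∅ elements

    #-all : Universal P → # P? ≡ length elements
    #-all U = count-all P? U elements

    #-witness : # P? ≢ 0 → Satisfiable P
    #-witness = count-witness P? elements

    #-singleton : ∀ u → P ≐ (_≈ u) → # P? ≡ 1
    #-singleton u P≐u = ≡.trans (count-cong P? (_≟ u) P≐u elements) (occurs-once u)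

  module _ {P : Pred Carrier p} {Q : Pred Carrier q} (P? : Decidable P) (Q? : Decidable Q) where

    #-cong : P ≐ Q → # P? ≡ # Q?
    #-cong P≐Q = count-cong P? Q? P≐Q elements

    #-split : # P? ≡ # (P? ∩? Q?) ℕ.+ # (P? ∩? ∁? Q?)
    #-split = count-split P? Q? elements

  module _ {P : Pred Carrier p} (P? : Decidable P) (P-resp : P Respects _≈_) where

    #-split-at : ∀ {u} → P u → # P? ≡ suc (# (P? ∩? ∁? (_≟ u)))
    #-split-at {u} pu = ≡.trans (#-split P? (_≟ u)) (≡.cong (ℕ._+ # (P? ∩? ∁? (_≟ u)))
      (#-singleton (P? ∩? (_≟ u)) u (proj₂ , λ x≈u → P-resp (sym x≈u) pu , x≈u)))

    #-nonzero : ∀ {u} → P u → # P? ≢ 0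
    #-nonzero pu #≡0 = ℕₚ.1+n≢0 (≡.trans (≡.sym (#-split-at pu)) #≡0)

    satisfiable? : Dec (Satisfiable P)
    satisfiable? with # P? ℕ.≟ 0
    ... | yes #≡0 = no λ (_ , pu) → #-nonzero pu #≡0
    ... | no  #≢0 = yes (#-witness P? #≢0)

    #-pair : ∀ {u v} → ¬ u ≈ v → P ≐ (λ x → x ≈ u ⊎ x ≈ v) → # P? ≡ 2
    #-pair {u} {v} u≉v (P⊆ , ⊆P) =
      ≡.trans (#-split-at (⊆P (inj₁ refl))) (≡.cong suc (#-singleton (P? ∩? ∁? (_≟ u)) v (from , to)))
      where
      from : P ∩ ∁ (_≈ u) ⊆ (_≈ v)
      from (px , x≉u) = [ (λ x≈u → contradiction x≈u x≉u) , id ]′ (P⊆ px)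
      to : (_≈ v) ⊆ P ∩ ∁ (_≈ u)
      to x≈v = ⊆P (inj₂ x≈v) , λ x≈u → u≉v (trans (sym x≈u) x≈v)

module FiniteDecSetoidMaps (S : FiniteDecSetoid a ℓ₁) (T : FiniteDecSetoid b ℓ₂) where
  private
    module S = FiniteDecSetoid S
    module T = FiniteDecSetoid T
  open FiniteDecSetoidProperties

  Image : Pred S.Carrier p → (S.Carrier → T.Carrier) → Pred T.Carrier (a ⊔ p ⊔ ℓ₂)
  Image P f y = ∃ λ x → P x × f x T.≈ y

  module _ {P : Pred S.Carrier p} (P? : Decidable P) (P-resp : P Respects S._≈_)
           (f : S.Carrier → T.Carrier) (f-cong : Congruent S._≈_ T._≈_ f) where

    fibre? : ∀ y → Decidable (λ x → P x × f x T.≈ y)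
    fibre? y = P? ∩? (λ x → f x T.≟ y)

    fibre-resp : ∀ y → (λ x → P x × f x T.≈ y) Respects S._≈_
    fibre-resp y x≈x′ (px , fx≈y) = P-resp x≈x′ px , T.trans (T.sym (f-cong x≈x′)) fx≈y

    image? : Decidable (Image P f)
    image? y = satisfiable? S (fibre? y) (fibre-resp y)

    image-resp : Image P f Respects T._≈_
    image-resp y≈y′ (x , px , fx≈y) = x , px , T.trans fx≈y y≈y′

    private
      -- Induction on # Q: remove one point y₀ of Q together with its fibre.
      #-fibres-over : ∀ n m {Q : Pred T.Carrier q} (Q? : Decidable Q) → Q Respects T._≈_ → T.# Q? ≡ n →
        (∀ {y} → Q y → S.# (fibre? y) ≡ m) → S.# (P? ∩? (Q? ∘ f)) ≡ n ℕ.* m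
      #-fibres-over zero m Q? Q-resp #Q≡0 fibres =
        #-none S (P? ∩? (Q? ∘ f)) λ _ (_ , qfx) → #-nonzero T Q? Q-resp qfx #Q≡0
      #-fibres-over (suc n) m {Q} Q? Q-resp #Q≡1+n fibres
        with y₀ , qy₀ ← #-witness T Q? (λ #Q≡0 → ℕₚ.1+n≢0 (≡.trans (≡.sym #Q≡1+n) #Q≡0)) = begin
        S.# (P? ∩? (Q? ∘ f))
          ≡⟨ #-split S (P? ∩? (Q? ∘ f)) (λ x → f x T.≟ y₀) ⟩
        S.# ((P? ∩? (Q? ∘ f)) ∩? (λ x → f x T.≟ y₀)) ℕ.+ S.# ((P? ∩? (Q? ∘ f)) ∩? ∁? (λ x → f x T.≟ y₀))
          ≡⟨ ≡.cong₂ ℕ._+_ (#-cong S _ (fibre? y₀) (over-y₀ , under-y₀))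
                           (#-cong S _ (P? ∩? (Q′? ∘ f)) (reassoc , unassoc)) ⟩
        S.# (fibre? y₀) ℕ.+ S.# (P? ∩? (Q′? ∘ f))
          ≡⟨ ≡.cong₂ ℕ._+_ (fibres qy₀) (#-fibres-over n m Q′? Q′-resp #Q′≡n (fibres ∘ proj₁)) ⟩
        m ℕ.+ n ℕ.* m
          ∎
        where
        open ≡.≡-Reasoning
        Q′? : Decidable (Q ∩ ∁ (T._≈ y₀))
        Q′? = Q? ∩? ∁? (T._≟ y₀)
        Q′-resp : (Q ∩ ∁ (T._≈ y₀)) Respects T._≈_
        Q′-resp y≈y′ (qy , y≉y₀) = Q-resp y≈y′ qy , λ y′≈y₀ → y≉y₀ (T.trans y≈y′ y′≈y₀)
        #Q′≡n : T.# Q′? ≡ n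
        #Q′≡n = ℕₚ.suc-injective (≡.trans (≡.sym (#-split-at T Q? Q-resp qy₀)) #Q≡1+n)
        over-y₀ : (P ∩ (Q ∘ f)) ∩ (λ x → f x T.≈ y₀) ⊆ (λ x → P x × f x T.≈ y₀)
        over-y₀ ((px , _) , fx≈y₀) = px , fx≈y₀
        under-y₀ : (λ x → P x × f x T.≈ y₀) ⊆ (P ∩ (Q ∘ f)) ∩ (λ x → f x T.≈ y₀)
        under-y₀ (px , fx≈y₀) = (px , Q-resp (T.sym fx≈y₀) qy₀) , fx≈y₀
        reassoc : (P ∩ (Q ∘ f)) ∩ ∁ (λ x → f x T.≈ y₀) ⊆ P ∩ ((Q ∩ ∁ (T._≈ y₀)) ∘ f)
        reassoc ((px , qfx) , fx≉y₀) = px , qfx , fx≉y₀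
        unassoc : P ∩ ((Q ∩ ∁ (T._≈ y₀)) ∘ f) ⊆ (P ∩ (Q ∘ f)) ∩ ∁ (λ x → f x T.≈ y₀)
        unassoc (px , qfx , fx≉y₀) = (px , qfx) , fx≉y₀

    #-fibres : ∀ {Q : Pred T.Carrier q} (Q? : Decidable Q) m → Q Respects T._≈_ → (∀ {x} → P x → Q (f x)) →
      (∀ {y} → Q y → S.# (fibre? y) ≡ m) → S.# P? ≡ T.# Q? ℕ.* m
    #-fibres Q? m Q-resp maps-to fibres = ≡.trans (#-cong S P? (P? ∩? (Q? ∘ f)) ((λ px → px , maps-to px) , proj₁))
                                                  (#-fibres-over _ m Q? Q-resp ≡.refl fibres)

    #-bijection : ∀ {Q : Pred T.Carrier q} (Q? : Decidable Q) → Q Respects T._≈_ →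
      (g : T.Carrier → S.Carrier) → Congruent T._≈_ S._≈_ g →
      (∀ {x} → P x → Q (f x)) → (∀ {y} → Q y → P (g y)) →
      (∀ {x} → P x → g (f x) S.≈ x) → (∀ {y} → Q y → f (g y) T.≈ y) →
      S.# P? ≡ T.# Q?
    #-bijection {Q = Q} Q? Q-resp g g-cong maps-to maps-from g∘f f∘g =
      ≡.trans (#-fibres Q? 1 Q-resp maps-to fibre-singleton) (ℕₚ.*-identityʳ _)
      where
      fibre-singleton : ∀ {y} → Q y → S.# (fibre? y) ≡ 1
      fibre-singleton {y} qy = #-singleton S (fibre? y) (g y)
        ( (λ (px , fx≈y) → S.trans (S.sym (g∘f px)) (g-cong fx≈y))
        , (λ x≈gy → P-resp (S.sym x≈gy) (maps-from qy) , T.trans (f-cong x≈gy) (f∘g qy)))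

    #-image-injective : (∀ {x x′} → P x → P x′ → f x T.≈ f x′ → x S.≈ x′) → S.# P? ≡ T.# image?
    #-image-injective injective =
      ≡.trans (#-fibres image? 1 image-resp (λ px → _ , px , T.refl) fibre-singleton) (ℕₚ.*-identityʳ _)
      where
      fibre-singleton : ∀ {y} → Image P f y → S.# (fibre? y) ≡ 1
      fibre-singleton {y} (x₀ , px₀ , fx₀≈y) = #-singleton S (fibre? y) x₀
        ( (λ (px , fx≈y) → injective px px₀ (T.trans fx≈y (T.sym fx₀≈y)))
        , (λ x≈x₀ → P-resp (S.sym x≈x₀) px₀ , T.trans (f-cong x≈x₀) fx₀≈y))

    injective⇒surjective : ∀ {Q : Pred T.Carrier q} (Q? : Decidable Q) → Q Respects T._≈_ →
      (∀ {x} → P x → Q (f x)) → (∀ {x x′} → P x → P x′ → f x T.≈ f x′ → x S.≈ x′) →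
      S.# P? ≡ T.# Q? → Q ⊆ Image P f
    injective⇒surjective {Q = Q} Q? Q-resp maps-to injective #P≡#Q {y} qy with image? y
    ... | yes y∈image = y∈image
    ... | no  y∉image = contradiction #rest≡0 (#-nonzero T (Q? ∩? ∁? image?) rest-resp (qy , y∉image))
      where
      image⊆Q : Image P f ⊆ Q
      image⊆Q (_ , px , fx≈y′) = Q-resp fx≈y′ (maps-to px)
      #Q-split : T.# Q? ≡ T.# image? ℕ.+ T.# (Q? ∩? ∁? image?)
      #Q-split = ≡.trans (#-split T Q? image?)
        (≡.cong (ℕ._+ T.# (Q? ∩? ∁? image?)) (#-cong T (Q? ∩? image?) image? (proj₂ , λ i → image⊆Q i , i)))
      #rest≡0 : T.# (Q? ∩? ∁? image?) ≡ 0
      #rest≡0 = ℕₚ.+-cancelˡ-≡ (T.# image?) _ 0 (≡.trans (≡.sym #Q-split)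
        (≡.trans (≡.sym #P≡#Q) (≡.trans (#-image-injective injective) (≡.sym (ℕₚ.+-identityʳ _)))))
      rest-resp : (Q ∩ ∁ (Image P f)) Respects T._≈_
      rest-resp y≈y′ (qy′ , y∉) = Q-resp y≈y′ qy′ , y∉ ∘ image-resp (T.sym y≈y′)

    #-two-to-one : (σ : S.Carrier → S.Carrier) → (∀ {x} → P x → P (σ x)) → (∀ {x} → P x → ¬ σ x S.≈ x) →
      (∀ x → f (σ x) T.≈ f x) → (∀ {x x′} → f x T.≈ f x′ → x S.≈ x′ ⊎ x S.≈ σ x′) →
      S.# P? ≡ T.# image? ℕ.* 2
    #-two-to-one σ P-σ σ-moves f∘σ f-fibres = #-fibres image? 2 image-resp (λ px → _ , px , T.refl) fibre-pair
      where
      fibre-pair : ∀ {y} → Image P f y → S.# (fibre? y) ≡ 2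
      fibre-pair {y} (x₀ , px₀ , fx₀≈y) = #-pair S (fibre? y) (fibre-resp y) (σ-moves px₀ ∘ S.sym) (from , to)
        where
        from : ∀ {x} → P x × f x T.≈ y → x S.≈ x₀ ⊎ x S.≈ σ x₀
        from (_ , fx≈y) = f-fibres (T.trans fx≈y (T.sym fx₀≈y))
        to : ∀ {x} → x S.≈ x₀ ⊎ x S.≈ σ x₀ → P x × f x T.≈ y
        to (inj₁ x≈x₀)  = P-resp (S.sym x≈x₀) px₀ , T.trans (f-cong x≈x₀) fx₀≈y
        to (inj₂ x≈σx₀) = P-resp (S.sym x≈σx₀) (P-σ px₀) , T.trans (f-cong x≈σx₀) (T.trans (f∘σ x₀) fx₀≈y)

module FiniteFieldProperties {c ℓ} (F : FiniteField c ℓ) where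
  open FiniteField F
  open import Algebra.Properties.Ring ring using (-‿involutive; -0#≈0#; x∙y⁻¹≈ε⇒x≈y; +-inverseˡ-unique)
  open import Relation.Binary.Reasoning.Setoid setoid
  open ℤ-CoefficientSolver cring using (solve; _:=_; _:+_; _:*_; _:-_; :-_; con)

  x*y≈0⇒x≈0∨y≈0 : ∀ {x y} → x * y ≈ 0# → x ≈ 0# ⊎ y ≈ 0#
  x*y≈0⇒x≈0∨y≈0 {x} {y} xy≈0 with x ≟ 0#
  ... | yes x≈0 = inj₁ x≈0
  ... | no  x≉0 = let x⁻¹ , xx⁻¹≈1 = inverse x x≉0 in inj₂ (begin
    y              ≈⟨ *-identityˡ y ⟨
    1# * y         ≈⟨ *-congʳ xx⁻¹≈1 ⟨
    (x * x⁻¹) * y  ≈⟨ solve 3 (λ x x⁻¹ y → (x :* x⁻¹) :* y := x⁻¹ :* (x :* y)) refl x x⁻¹ y ⟩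
    x⁻¹ * (x * y)  ≈⟨ *-congˡ xy≈0 ⟩
    x⁻¹ * 0#       ≈⟨ zeroʳ x⁻¹ ⟩
    0#             ∎)

  x*x≈0⇒x≈0 : ∀ {x} → x * x ≈ 0# → x ≈ 0#
  x*x≈0⇒x≈0 xx≈0 = [ id , id ]′ (x*y≈0⇒x≈0∨y≈0 xx≈0)

  x*x≈y*y⇒x≈y∨x≈-y : ∀ {x y} → x * x ≈ y * y → x ≈ y ⊎ x ≈ - y
  x*x≈y*y⇒x≈y∨x≈-y {x} {y} xx≈yy =
    Data.Sum.map (x∙y⁻¹≈ε⇒x≈y x y) (+-inverseˡ-unique x y) (x*y≈0⇒x≈0∨y≈0 (begin
      (x - y) * (x + y)  ≈⟨ solve 2 (λ x y → (x :- y) :* (x :+ y) := x :* x :- y :* y) refl x y ⟩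
      x * x - y * y      ≈⟨ +-congʳ xx≈yy ⟩
      y * y - y * y      ≈⟨ -‿inverseʳ (y * y) ⟩
      0#                 ∎))

  -x≈0⇒x≈0 : ∀ {x} → - x ≈ 0# → x ≈ 0#
  -x≈0⇒x≈0 {x} -x≈0 = trans (sym (-‿involutive x)) (trans (-‿cong -x≈0) -0#≈0#)

  x≉0∧y≉0⇒x*y≉0 : ∀ {x y} → ¬ x ≈ 0# → ¬ y ≈ 0# → ¬ x * y ≈ 0#
  x≉0∧y≉0⇒x*y≉0 x≉0 y≉0 xy≈0 = [ x≉0 , y≉0 ]′ (x*y≈0⇒x≈0∨y≈0 xy≈0)

  -x*-x≈x*x : ∀ x → - x * - x ≈ x * x
  -x*-x≈x*x = solve 1 (λ x → (:- x) :* (:- x) := x :* x) refl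

  -x≈x⇒x≈0 : ¬ (1# + 1#) ≈ 0# → ∀ {x} → - x ≈ x → x ≈ 0#
  -x≈x⇒x≈0 2≉0 {x} -x≈x = [ (λ 2≈0 → contradiction 2≈0 2≉0) , id ]′ (x*y≈0⇒x≈0∨y≈0 (begin
    (1# + 1#) * x  ≈⟨ solve 1 (λ x → con (+ 2) :* x := x :- (:- x)) refl x ⟩
    x - - x        ≈⟨ +-congˡ (-‿cong -x≈x) ⟩
    x - x          ≈⟨ -‿inverseʳ x ⟩
    0#             ∎))

  𝔽 : FiniteDecSetoid c ℓ
  𝔽 = record
    { decSetoid   = record { isDecEquivalence = record { isEquivalence = isEquivalence ; _≟_ = _≟_ } }
    ; elements    = tabulate enum
    ; occurs-once = λ x → let m , enum-m≈x = enum-surj x in ≡.trans (count-tabulate (_≟ x) enum)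
        (countFin-unique (λ n → enum n ≟ x) m enum-m≈x λ enum-n≈x → enum-inj _ _ (trans enum-n≈x (sym enum-m≈x)))
    }

  open FiniteDecSetoid 𝔽 using (#_)
  open FiniteDecSetoidProperties 𝔽
  open FiniteDecSetoidMaps 𝔽 𝔽

  NonZero : Pred Carrier ℓ
  NonZero x = ¬ x ≈ 0#

  nonZero? : Decidable NonZero
  nonZero? = ∁? (_≟ 0#)

  nonZero-resp : NonZero Respects _≈_
  nonZero-resp x≈y x≉0 y≈0 = x≉0 (trans x≈y y≈0)

  #𝔽≡size : # U? ≡ size
  #𝔽≡size = ≡.trans (#-all U? _) (length-tabulate enum)

  size≡1+#nonZero : size ≡ suc (# nonZero?)
  size≡1+#nonZero = ≡.trans (≡.sym #𝔽≡size)
    (≡.trans (#-split-at U? _ {0#} _) (≡.cong suc (#-cong _ nonZero? (proj₂ , (_ ,_)))))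

  square : Carrier → Carrier
  square x = x * x

  square-cong : Congruent _≈_ _≈_ square
  square-cong x≈y = *-cong x≈y x≈y

  isSquare-resp : IsSquare F Respects _≈_
  isSquare-resp x≈y (r , rr≈x) = r , trans rr≈x x≈y

  roots? : ∀ D → Decidable (λ r → r * r ≈ D)
  roots? D r = (r * r) ≟ D

  roots-resp : ∀ D → (λ r → r * r ≈ D) Respects _≈_
  roots-resp D r≈r′ rr≈D = trans (square-cong (sym r≈r′)) rr≈D

  nonsquare⇒nonZero : ∀ {x} → ¬ IsSquare F x → NonZero x
  nonsquare⇒nonZero x∉□ x≈0 = x∉□ (0# , trans (zeroˡ 0#) (sym x≈0))

  isSquare? : Decidable (IsSquare F)
  isSquare? x = satisfiable? (roots? x) (roots-resp x)

  ratio-of-squares : ∀ {x y} → NonZero x → IsSquare F x → IsSquare F y → ∃ λ r → x * (r * r) ≈ y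
  ratio-of-squares {x} {y} x≉0 (s , ss≈x) (t , tt≈y) = t * s⁻¹ , (begin
    x * ((t * s⁻¹) * (t * s⁻¹))        ≈⟨ *-congʳ ss≈x ⟨
    (s * s) * ((t * s⁻¹) * (t * s⁻¹))  ≈⟨ solve 3 (λ s t s⁻¹ → (s :* s) :* ((t :* s⁻¹) :* (t :* s⁻¹))
                                                  := ((s :* s⁻¹) :* (s :* s⁻¹)) :* (t :* t)) refl s t s⁻¹ ⟩
    ((s * s⁻¹) * (s * s⁻¹)) * (t * t)  ≈⟨ *-cong (trans (*-cong ss⁻¹≈1 ss⁻¹≈1) (*-identityˡ 1#)) tt≈y ⟩
    1# * y                             ≈⟨ *-identityˡ y ⟩
    y                                  ∎)
    where
    s≉0 : NonZero s
    s≉0 s≈0 = x≉0 (trans (sym ss≈x) (trans (square-cong s≈0) (zeroˡ 0#)))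
    s⁻¹ : Carrier
    s⁻¹ = proj₁ (inverse s s≉0)
    ss⁻¹≈1 : s * s⁻¹ ≈ 1#
    ss⁻¹≈1 = proj₂ (inverse s s≉0)

  □* : Pred Carrier (c ⊔ ℓ)
  □* = Image NonZero square

  □*? : Decidable □*
  □*? = image? nonZero? nonZero-resp square square-cong

  □*-resp : □* Respects _≈_
  □*-resp = image-resp nonZero? nonZero-resp square square-cong

  □*⊆NonZero : □* ⊆ NonZero
  □*⊆NonZero (r , r≉0 , rr≈x) x≈0 = r≉0 (x*x≈0⇒x≈0 (trans rr≈x x≈0))

  □*⊆□ : □* ⊆ IsSquare F
  □*⊆□ (r , _ , rr≈x) = r , rr≈x

  module _ {p} {P : Pred Carrier p} (P? : Decidable P) (P-resp : P Respects _≈_) where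

    #-squaring : ¬ (1# + 1#) ≈ 0# → P ⊆ NonZero → (∀ {x} → P x → P (- x)) →
      # P? ≡ # (image? P? P-resp square square-cong) ℕ.* 2
    #-squaring 2≉0 P⊆NonZero P-neg = #-two-to-one P? P-resp square square-cong -_ P-neg
      (λ px -x≈x → P⊆NonZero px (-x≈x⇒x≈0 2≉0 -x≈x)) -x*-x≈x*x x*x≈y*y⇒x≈y∨x≈-y

  #roots-nonsquare : ∀ {D} → ¬ IsSquare F D → # (roots? D) ≡ 0
  #roots-nonsquare D∉□ = #-none (roots? _) (λ r rr≈D → D∉□ (r , rr≈D))

  #roots-zero : ∀ {D} → D ≈ 0# → # (roots? D) ≡ 1
  #roots-zero D≈0 = #-singleton (roots? _) 0#
    ( (λ rr≈D → x*x≈0⇒x≈0 (trans rr≈D D≈0))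
    , (λ r≈0 → trans (square-cong r≈0) (trans (zeroˡ 0#) (sym D≈0))))

  #roots-square : ∀ {D} → ¬ (1# + 1#) ≈ 0# → NonZero D → IsSquare F D → # (roots? D) ≡ 2
  #roots-square {D} 2≉0 D≉0 (r , rr≈D) = #-pair (roots? D) (roots-resp D) -r≉r
    ( (λ ss≈D → x*x≈y*y⇒x≈y∨x≈-y (trans ss≈D (sym rr≈D)))
    , [ (λ s≈r → trans (square-cong s≈r) rr≈D)
      , (λ s≈-r → trans (square-cong s≈-r) (trans (-x*-x≈x*x r) rr≈D)) ]′)
    where
    -r≉r : ¬ r ≈ - r
    -r≉r r≈-r = D≉0 (trans (sym rr≈D) (trans (square-cong (-x≈x⇒x≈0 2≉0 (sym r≈-r))) (zeroˡ 0#)))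

  module CharacteristicTwo (2≈0 : (1# + 1#) ≈ 0#) where

    2x≈0 : ∀ x → (1# + 1#) * x ≈ 0#
    2x≈0 x = trans (*-congʳ 2≈0) (zeroˡ x)

    -x≈x : ∀ x → - x ≈ x
    -x≈x x = begin
      - x                  ≈⟨ +-identityʳ (- x) ⟨
      - x + 0#             ≈⟨ +-congˡ (2x≈0 x) ⟨
      - x + (1# + 1#) * x  ≈⟨ solve 1 (λ x → :- x :+ con (+ 2) :* x := x) refl x ⟩
      x                    ∎

    artin-schreier : Carrier → Carrier
    artin-schreier x = x * x + x

    artin-schreier-cong : Congruent _≈_ _≈_ artin-schreier
    artin-schreier-cong x≈y = +-cong (square-cong x≈y) x≈y

    artin-schreier[x+1]≈artin-schreier[x] : ∀ x → artin-schreier (x + 1#) ≈ artin-schreier x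
    artin-schreier[x+1]≈artin-schreier[x] x = begin
      (x + 1#) * (x + 1#) + (x + 1#)        ≈⟨ solve 1 (λ x → (x :+ con (+ 1)) :* (x :+ con (+ 1)) :+ (x :+ con (+ 1))
                                                              := (x :* x :+ x) :+ con (+ 2) :* (x :+ con (+ 1))) refl x ⟩
      (x * x + x) + (1# + 1#) * (x + 1#)    ≈⟨ +-congˡ (2x≈0 (x + 1#)) ⟩
      (x * x + x) + 0#                      ≈⟨ +-identityʳ (x * x + x) ⟩
      x * x + x                             ∎

    artin-schreier-fibres : ∀ {x y} → artin-schreier x ≈ artin-schreier y → x ≈ y ⊎ x ≈ y + 1#
    artin-schreier-fibres {x} {y} fx≈fy =
      Data.Sum.map (x∙y⁻¹≈ε⇒x≈y x y) (λ e → trans (+-inverseˡ-unique x (y + 1#) e) (-x≈x _)) (x*y≈0⇒x≈0∨y≈0 (begin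
        (x - y) * (x + (y + 1#))     ≈⟨ solve 2 (λ x y → (x :- y) :* (x :+ (y :+ con (+ 1)))
                                                         := (x :* x :+ x) :- (y :* y :+ y)) refl x y ⟩
        (x * x + x) - (y * y + y)    ≈⟨ +-congʳ fx≈fy ⟩
        (y * y + y) - (y * y + y)    ≈⟨ -‿inverseʳ (y * y + y) ⟩
        0#                           ∎))

    x+1≉x : ∀ {x} → U x → ¬ x + 1# ≈ x
    x+1≉x {x} _ x+1≈x = 1≉0 (begin
      1#            ≈⟨ solve 1 (λ x → con (+ 1) := (x :+ con (+ 1)) :- x) refl x ⟩
      (x + 1#) - x  ≈⟨ +-congʳ x+1≈x ⟩
      x - x         ≈⟨ -‿inverseʳ x ⟩
      0#            ∎)

    size-even : size % 2 ≡ 0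
    size-even = ≡.trans (≡.cong (_% 2) (≡.trans (≡.sym #𝔽≡size) (#-two-to-one U? _ artin-schreier artin-schreier-cong
      (_+ 1#) _ x+1≉x artin-schreier[x+1]≈artin-schreier[x] artin-schreier-fibres))) (m*n%n≡0 #image 2)
      where
      #image : ℕ
      #image = # (image? U? _ artin-schreier artin-schreier-cong)

  -- In characteristic 2 the Artin–Schreier map x ↦ x² + x is two-to-one, so q would be even.
  odd⇒1+1≉0 : size % 2 ≡ 1 → ¬ (1# + 1#) ≈ 0#
  odd⇒1+1≉0 size-odd 2≈0 = contradiction (≡.trans (≡.sym size-odd) (CharacteristicTwo.size-even 2≈0)) λ ()

  -- If −1 = i², the nonzero squares are closed under negation, so squaring is two-to-one on them
  -- as well as on F*; then 4 divides q − 1.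
  3mod4⇒-1∉□ : size % 4 ≡ 3 → ¬ IsSquare F (- 1#)
  3mod4⇒-1∉□ size≡3 (i , ii≈-1) = contradiction (≡.trans (≡.sym size≡3) size≡1) λ ()
    where
    2≉0 : ¬ (1# + 1#) ≈ 0#
    2≉0 = odd⇒1+1≉0
      (≡.trans (≡.sym (m∣n⇒o%n%m≡o%m 2 4 size (divides 2 ≡.refl))) (≡.cong (_% 2) size≡3))
    i≉0 : NonZero i
    i≉0 i≈0 = 1≉0 (-x≈0⇒x≈0 (trans (sym ii≈-1) (trans (*-congʳ i≈0) (zeroˡ i))))
    □*-neg : ∀ {x} → □* x → □* (- x)
    □*-neg {x} (r , r≉0 , rr≈x) = i * r , x≉0∧y≉0⇒x*y≉0 i≉0 r≉0 , (begin
      (i * r) * (i * r)  ≈⟨ solve 2 (λ i r → (i :* r) :* (i :* r) := (i :* i) :* (r :* r)) refl i r ⟩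
      (i * i) * (r * r)  ≈⟨ *-cong ii≈-1 rr≈x ⟩
      - 1# * x           ≈⟨ solve 1 (λ x → :- con (+ 1) :* x := :- x) refl x ⟩
      - x                ∎)
    #□*² : ℕ
    #□*² = # (image? □*? □*-resp square square-cong)
    #nonZero≡m*4 : # nonZero? ≡ #□*² ℕ.* 4
    #nonZero≡m*4 = ≡.trans (#-squaring nonZero? nonZero-resp 2≉0 id (_∘ -x≈0⇒x≈0))
      (≡.trans (≡.cong (ℕ._* 2) (#-squaring □*? □*-resp 2≉0 □*⊆NonZero □*-neg)) (ℕₚ.*-assoc #□*² 2 2))
    size≡1 : size % 4 ≡ 1
    size≡1 = ≡.trans (≡.cong (_% 4) (≡.trans size≡1+#nonZero (≡.cong suc #nonZero≡m*4)))
                     ([m+kn]%n≡m%n 1 #□*² 4)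

module PlaneGeometry {c ℓ} (F : FiniteField c ℓ) where
  open FiniteField F
  open FiniteFieldProperties F using (𝔽; #𝔽≡size; square-cong)
  open ℤ-CoefficientSolver cring using (solve; _:=_; _:+_; _:*_; _:-_; :-_; con)

  Plane : FiniteDecSetoid c ℓ
  Plane = 𝔽 ×-finite 𝔽

  module Plane = FiniteDecSetoid Plane

  infix 4 _≋_
  _≋_ : Point F → Point F → Set ℓ
  _≋_ = Plane._≈_

  norm : Point F → Carrier
  norm (x , y) = x * x + y * y

  _⊕_ : Point F → Point F → Point F
  (x , y) ⊕ (x′ , y′) = (x + x′ , y + y′)

  _⊖_ : Point F → Point F → Point F
  (x , y) ⊖ (x′ , y′) = (x - x′ , y - y′)

  _⋆_ : Carrier → Point F → Point F
  k ⋆ (x , y) = (k * x , k * y)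

  _∙_ : Point F → Point F → Carrier
  (x , y) ∙ (x′ , y′) = x * x′ + y * y′

  _∧_ : Point F → Point F → Carrier
  (x , y) ∧ (x′ , y′) = y * x′ - x * y′

  rot : Point F → Point F
  rot (x , y) = (- y , x)

  conj : Point F → Point F
  conj (x , y) = (x , - y)

  _·_ : Point F → Point F → Point F
  (x , y) · (x′ , y′) = (x * x′ - y * y′ , x * y′ + y * x′)

  norm-cong : Congruent _≋_ _≈_ norm
  norm-cong (x≈x′ , y≈y′) = +-cong (square-cong x≈x′) (square-cong y≈y′)

  ⊕-cong : ∀ {z z′ w w′} → z ≋ z′ → w ≋ w′ → z ⊕ w ≋ z′ ⊕ w′
  ⊕-cong (x≈x′ , y≈y′) (a≈a′ , b≈b′) = +-cong x≈x′ a≈a′ , +-cong y≈y′ b≈b′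

  ⊖-cong : ∀ {z z′ w w′} → z ≋ z′ → w ≋ w′ → z ⊖ w ≋ z′ ⊖ w′
  ⊖-cong (x≈x′ , y≈y′) (a≈a′ , b≈b′) = +-cong x≈x′ (-‿cong a≈a′) , +-cong y≈y′ (-‿cong b≈b′)

  ⋆-cong : ∀ {k k′ z z′} → k ≈ k′ → z ≋ z′ → k ⋆ z ≋ k′ ⋆ z′
  ⋆-cong k≈k′ (x≈x′ , y≈y′) = *-cong k≈k′ x≈x′ , *-cong k≈k′ y≈y′

  ∙-congʳ : ∀ {z z′} w → z ≋ z′ → z ∙ w ≈ z′ ∙ w
  ∙-congʳ w (x≈x′ , y≈y′) = +-cong (*-congʳ x≈x′) (*-congʳ y≈y′)

  ∧-congʳ : ∀ {z z′} w → z ≋ z′ → z ∧ w ≈ z′ ∧ w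
  ∧-congʳ w (x≈x′ , y≈y′) = +-cong (*-congʳ y≈y′) (-‿cong (*-congʳ x≈x′))

  ·-congˡ : ∀ u → Congruent _≋_ _≋_ (u ·_)
  ·-congˡ (a , b) (x≈x′ , y≈y′) = +-cong (*-congˡ x≈x′) (-‿cong (*-congˡ y≈y′)) , +-cong (*-congˡ y≈y′) (*-congˡ x≈x′)

  ⊕⊖-cancel : ∀ z w → (z ⊕ w) ⊖ z ≋ w
  ⊕⊖-cancel (x , y) (a , b) = cancel x a , cancel y b
    where
    cancel : ∀ x a → (x + a) - x ≈ a
    cancel = solve 2 (λ x a → (x :+ a) :- x := a) refl

  ⊕⊖-inverse : ∀ z w → z ⊕ (w ⊖ z) ≋ w
  ⊕⊖-inverse (x , y) (a , b) = cancel x a , cancel y b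
    where
    cancel : ∀ x a → x + (a - x) ≈ a
    cancel = solve 2 (λ x a → x :+ (a :- x) := a) refl

  1⋆z≋z : ∀ z → 1# ⋆ z ≋ z
  1⋆z≋z (x , y) = *-identityˡ x , *-identityˡ y

  ⋆-assoc : ∀ s t z → s ⋆ (t ⋆ z) ≋ (s * t) ⋆ z
  ⋆-assoc s t (x , y) = sym (*-assoc s t x) , sym (*-assoc s t y)

  norm-· : ∀ u z → norm (u · z) ≈ norm u * norm z
  norm-· (a , b) (x , y) = solve 4 (λ a b x y →
    (a :* x :- b :* y) :* (a :* x :- b :* y) :+ (a :* y :+ b :* x) :* (a :* y :+ b :* x)
      := (a :* a :+ b :* b) :* (x :* x :+ y :* y)) refl a b x y

  norm-⋆conj· : ∀ k u z → norm ((k ⋆ conj u) · z) ≈ (k * k) * (norm u * norm z)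
  norm-⋆conj· k (a , b) (x , y) = solve 5 (λ k a b x y →
    (k :* a :* x :- k :* (:- b) :* y) :* (k :* a :* x :- k :* (:- b) :* y)
      :+ (k :* a :* y :+ k :* (:- b) :* x) :* (k :* a :* y :+ k :* (:- b) :* x)
      := (k :* k) :* ((a :* a :+ b :* b) :* (x :* x :+ y :* y))) refl k a b x y

  ⋆conj·-cancel : ∀ k u z → (k ⋆ conj u) · (u · z) ≋ (k * norm u) ⋆ z
  ⋆conj·-cancel k (a , b) (x , y) =
    solve 5 (λ k a b x y → k :* a :* (a :* x :- b :* y) :- k :* (:- b) :* (a :* y :+ b :* x)
                           := k :* (a :* a :+ b :* b) :* x) refl k a b x y ,
    solve 5 (λ k a b x y → k :* a :* (a :* y :+ b :* x) :+ k :* (:- b) :* (a :* x :- b :* y)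
                           := k :* (a :* a :+ b :* b) :* y) refl k a b x y

  ·⋆conj-cancel : ∀ k u z → u · ((k ⋆ conj u) · z) ≋ (k * norm u) ⋆ z
  ·⋆conj-cancel k (a , b) (x , y) =
    solve 5 (λ k a b x y → a :* (k :* a :* x :- k :* (:- b) :* y) :- b :* (k :* a :* y :+ k :* (:- b) :* x)
                           := k :* (a :* a :+ b :* b) :* x) refl k a b x y ,
    solve 5 (λ k a b x y → a :* (k :* a :* y :+ k :* (:- b) :* x) :+ b :* (k :* a :* x :- k :* (:- b) :* y)
                           := k :* (a :* a :+ b :* b) :* y) refl k a b x y

  law-of-cosines : ∀ α β γ →
    quadrance F γ β ≈ (quadrance F α γ + quadrance F α β) - (1# + 1#) * ((γ ⊖ α) ∙ (β ⊖ α))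
  law-of-cosines (a₁ , a₂) (b₁ , b₂) (g₁ , g₂) = solve 6 (λ a₁ a₂ b₁ b₂ g₁ g₂ →
    (b₁ :- g₁) :* (b₁ :- g₁) :+ (b₂ :- g₂) :* (b₂ :- g₂)
      := ((g₁ :- a₁) :* (g₁ :- a₁) :+ (g₂ :- a₂) :* (g₂ :- a₂) :+ ((b₁ :- a₁) :* (b₁ :- a₁) :+ (b₂ :- a₂) :* (b₂ :- a₂)))
         :- con (+ 2) :* ((g₁ :- a₁) :* (b₁ :- a₁) :+ (g₂ :- a₂) :* (b₂ :- a₂))) refl a₁ a₂ b₁ b₂ g₁ g₂

  lagrange : ∀ z w → (z ∙ w) * (z ∙ w) + (z ∧ w) * (z ∧ w) ≈ norm z * norm w
  lagrange (x , y) (a , b) = solve 4 (λ x y a b →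
    (x :* a :+ y :* b) :* (x :* a :+ y :* b) :+ (y :* a :- x :* b) :* (y :* a :- x :* b)
      := (x :* x :+ y :* y) :* (a :* a :+ b :* b)) refl x y a b

  frame-decomposition : ∀ z w → norm w ⋆ z ≋ ((z ∙ w) ⋆ w) ⊕ ((z ∧ w) ⋆ rot w)
  frame-decomposition (x , y) (a , b) =
    solve 4 (λ x y a b → (a :* a :+ b :* b) :* x := (x :* a :+ y :* b) :* a :+ (y :* a :- x :* b) :* (:- b)) refl x y a b ,
    solve 4 (λ x y a b → (a :* a :+ b :* b) :* y := (x :* a :+ y :* b) :* b :+ (y :* a :- x :* b) :* a) refl x y a b

  frame-∙ : ∀ s c d w → (s ⋆ ((c ⋆ w) ⊕ (d ⋆ rot w))) ∙ w ≈ s * (c * norm w)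
  frame-∙ s c d (a , b) = solve 5 (λ s c d a b →
    s :* (c :* a :+ d :* (:- b)) :* a :+ s :* (c :* b :+ d :* a) :* b := s :* (c :* (a :* a :+ b :* b))) refl s c d a b

  frame-∧ : ∀ s c d w → (s ⋆ ((c ⋆ w) ⊕ (d ⋆ rot w))) ∧ w ≈ s * (d * norm w)
  frame-∧ s c d (a , b) = solve 5 (λ s c d a b →
    s :* (c :* b :+ d :* a) :* a :- s :* (c :* a :+ d :* (:- b)) :* b := s :* (d :* (a :* a :+ b :* b))) refl s c d a b

  frame-norm : ∀ s c d w → norm (s ⋆ ((c ⋆ w) ⊕ (d ⋆ rot w))) ≈ (s * s) * ((c * c + d * d) * norm w)
  frame-norm s c d (a , b) = solve 5 (λ s c d a b →
    s :* (c :* a :+ d :* (:- b)) :* (s :* (c :* a :+ d :* (:- b))) :+ s :* (c :* b :+ d :* a) :* (s :* (c :* b :+ d :* a))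
      := (s :* s) :* ((c :* c :+ d :* d) :* (a :* a :+ b :* b))) refl s c d a b

  Circle : Carrier → Pred (Point F) ℓ
  Circle r z = norm z ≈ r

  circle? : ∀ r → Decidable (Circle r)
  circle? r z = norm z ≟ r

  circle-resp : ∀ r → Circle r Respects _≋_
  circle-resp r z≋z′ nz≈r = trans (sym (norm-cong z≋z′)) nz≈r

  origin : Point F
  origin = (0# , 0#)

  norm-origin : norm origin ≈ 0#
  norm-origin = trans (+-cong (zeroˡ 0#) (zeroˡ 0#)) (+-identityʳ 0#)

  nonOrigin? : Decidable (∁ (_≋ origin))
  nonOrigin? = ∁? (Plane._≟ origin)

  nonOrigin-resp : ∁ (_≋ origin) Respects _≋_
  nonOrigin-resp z≋z′ z≉0 z′≈0 = z≉0 (Plane.trans z≋z′ z′≈0)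

  #plane≡size² : Plane.# U? ≡ size ℕ.* size
  #plane≡size² = ≡.trans (#-cong U? (U? ×? U?) (_ , _))
    (≡.trans (count-cartesianProduct U? U? (tabulate enum) (tabulate enum)) (≡.cong₂ ℕ._*_ #𝔽≡size #𝔽≡size))
    where open FiniteDecSetoidProperties Plane

  #plane≡1+#nonOrigin : Plane.# U? ≡ suc (Plane.# nonOrigin?)
  #plane≡1+#nonOrigin = ≡.trans (#-split-at U? _ {origin} _) (≡.cong suc (#-cong _ nonOrigin? (proj₂ , (_ ,_))))
    where open FiniteDecSetoidProperties Plane

[1+n]²≡1+n*c⇒c≡2+n : ∀ n c → n ≢ 0 → suc n ℕ.* suc n ≡ suc (n ℕ.* c) → c ≡ suc (suc n)
[1+n]²≡1+n*c⇒c≡2+n n c n≢0 eq = ℕₚ.*-cancelˡ-≡ c (suc (suc n)) n {{ℕ.≢-nonZero n≢0}}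
  (≡.sym (≡.trans (ℕₚ.*-suc n (suc n)) (ℕₚ.suc-injective eq)))

module MinusOneNonSquare {c ℓ} (F : FiniteField c ℓ) (-1∉□ : ¬ IsSquare F (FiniteField.-_ F (FiniteField.1# F))) where
  open FiniteField F
  open FiniteFieldProperties F
  open PlaneGeometry F
  open FiniteDecSetoid 𝔽 using (#_)
  open FiniteDecSetoidProperties 𝔽
  open FiniteDecSetoidMaps 𝔽 𝔽
  open import Algebra.Properties.Ring ring using (-‿involutive; -‿injective; -‿distribˡ-*; +-inverseˡ-unique; +-cancelʳ)
  open import Relation.Binary.Reasoning.Setoid setoid
  open ℤ-CoefficientSolver cring using (solve; _:=_; _:+_; _:*_; :-_; con)

  1+1≉0 : ¬ (1# + 1#) ≈ 0#
  1+1≉0 2≈0 = -1∉□ (1# , trans (*-identityˡ 1#) (+-inverseˡ-unique 1# 1# 2≈0))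

  x*x+y*y≈0⇒y≈0 : ∀ {x y} → x * x + y * y ≈ 0# → y ≈ 0#
  x*x+y*y≈0⇒y≈0 {x} {y} sum≈0 with y ≟ 0#
  ... | yes y≈0 = y≈0
  ... | no  y≉0 = let y⁻¹ , yy⁻¹≈1 = inverse y y≉0 in contradiction (x * y⁻¹ , (begin
    (x * y⁻¹) * (x * y⁻¹)       ≈⟨ solve 2 (λ x y⁻¹ → (x :* y⁻¹) :* (x :* y⁻¹) := (x :* x) :* (y⁻¹ :* y⁻¹)) refl x y⁻¹ ⟩
    (x * x) * (y⁻¹ * y⁻¹)       ≈⟨ *-congʳ (+-inverseˡ-unique (x * x) (y * y) sum≈0) ⟩
    - (y * y) * (y⁻¹ * y⁻¹)     ≈⟨ solve 2 (λ y y⁻¹ → :- (y :* y) :* (y⁻¹ :* y⁻¹) := :- ((y :* y⁻¹) :* (y :* y⁻¹)))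
                                          refl y y⁻¹ ⟩
    - ((y * y⁻¹) * (y * y⁻¹))   ≈⟨ -‿cong (*-cong yy⁻¹≈1 yy⁻¹≈1) ⟩
    - (1# * 1#)                 ≈⟨ -‿cong (*-identityˡ 1#) ⟩
    - 1#                        ∎)) -1∉□

  x*x+y*y≈0⇒x≈0 : ∀ {x y} → x * x + y * y ≈ 0# → x ≈ 0#
  x*x+y*y≈0⇒x≈0 sum≈0 = x*x+y*y≈0⇒y≈0 (trans (+-comm _ _) sum≈0)

  x∈□∧-x∈□⇒x≈0 : ∀ {x} → IsSquare F x → IsSquare F (- x) → x ≈ 0#
  x∈□∧-x∈□⇒x≈0 {x} (r , rr≈x) (s , ss≈-x) = begin
    x        ≈⟨ rr≈x ⟨
    r * r    ≈⟨ square-cong (x*x+y*y≈0⇒x≈0 (trans (+-cong rr≈x ss≈-x) (-‿inverseʳ x))) ⟩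
    0# * 0#  ≈⟨ zeroˡ 0# ⟩
    0#       ∎

  -- Negation maps the (q − 1)/2 nonzero squares injectively into the (q − 1)/2 nonsquares.
  nonsquare⇒-x∈□ : ∀ {x} → ¬ IsSquare F x → IsSquare F (- x)
  nonsquare⇒-x∈□ {x} x∉□ =
    let r , r∈□* , -r≈x = injective⇒surjective □*? □*-resp -_ -‿cong non□? non□-resp maps-to
                            (λ _ _ → -‿injective) #□*≡#non□ (nonsquare⇒nonZero x∉□ , x∉□ ∘ □*⊆□)
    in isSquare-resp (trans (sym (-‿involutive r)) (-‿cong -r≈x)) (□*⊆□ r∈□*)
    where
    non□? : Decidable (NonZero ∩ ∁ □*)
    non□? = nonZero? ∩? ∁? □*?
    non□-resp : (NonZero ∩ ∁ □*) Respects _≈_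
    non□-resp x≈y (x≉0 , x∉□*) = nonZero-resp x≈y x≉0 , x∉□* ∘ □*-resp (sym x≈y)
    maps-to : ∀ {y} → □* y → (NonZero ∩ ∁ □*) (- y)
    maps-to {y} y∈□*@(r , r≉0 , rr≈y) =
      (λ -y≈0 → r≉0 (x*x≈0⇒x≈0 (trans rr≈y (-x≈0⇒x≈0 -y≈0)))) ,
      (λ -y∈□* → r≉0 (x*x≈0⇒x≈0 (trans rr≈y (x∈□∧-x∈□⇒x≈0 (□*⊆□ y∈□*) (□*⊆□ -y∈□*)))))
    #nonZero≡#□*+#□* : # nonZero? ≡ # □*? ℕ.+ # □*?
    #nonZero≡#□*+#□* = ≡.trans (#-squaring nonZero? nonZero-resp 1+1≉0 id (_∘ -x≈0⇒x≈0))
      (≡.trans (ℕₚ.*-comm (# □*?) 2) (≡.cong (# □*? ℕ.+_) (ℕₚ.+-identityʳ (# □*?))))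
    #nonZero≡#□*+#non□ : # nonZero? ≡ # □*? ℕ.+ # non□?
    #nonZero≡#□*+#non□ = ≡.trans (#-split nonZero? □*?)
      (≡.cong (ℕ._+ # non□?) (#-cong _ □*? (proj₂ , λ r∈□* → □*⊆NonZero r∈□* , r∈□*)))
    #□*≡#non□ : # □*? ≡ # non□?
    #□*≡#non□ = ℕₚ.+-cancelˡ-≡ (# □*?) _ _ (≡.trans (≡.sym #nonZero≡#□*+#□*) #nonZero≡#□*+#non□)

  -- Otherwise x ↦ x + 1 would permute the squares, and a square x with x + 1 = 0 would be −1.
  squares-not-closed-under-suc : ¬ (∀ a → IsSquare F (a * a + 1#))
  squares-not-closed-under-suc a²+1∈□ =
    let x , x∈□ , x+1≈0 = injective⇒surjective isSquare? isSquare-resp (_+ 1#) +-congʳ isSquare? isSquare-resp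
                            maps-to (λ _ _ → +-cancelʳ 1# _ _) ≡.refl (0# , zeroˡ 0#)
    in -1∉□ (isSquare-resp (+-inverseˡ-unique x 1# x+1≈0) x∈□)
    where
    maps-to : ∀ {x} → IsSquare F x → IsSquare F (x + 1#)
    maps-to (r , rr≈x) = let s , ss≈rr+1 = a²+1∈□ r in s , trans ss≈rr+1 (+-congʳ rr≈x)

  nonsquare-successor : ∃ λ a → ¬ IsSquare F (a * a + 1#)
  nonsquare-successor with satisfiable? (λ a → ∁? isSquare? (a * a + 1#))
                                        (λ a≈a′ a²+1∉□ → a²+1∉□ ∘ isSquare-resp (+-congʳ (square-cong (sym a≈a′))))
  ... | yes a,a²+1∉□ = a,a²+1∉□
  ... | no  ∄a       =
    contradiction (λ a → decidable-stable (isSquare? (a * a + 1#)) (∄a ∘ (a ,_))) squares-not-closed-under-suc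

  nonsquare-ratio : ∀ {x y} → ¬ IsSquare F x → ¬ IsSquare F y → ∃ λ r → x * (r * r) ≈ y
  nonsquare-ratio {x} {y} x∉□ y∉□ =
    let r , -xr²≈-y = ratio-of-squares (nonsquare⇒nonZero x∉□ ∘ -x≈0⇒x≈0) (nonsquare⇒-x∈□ x∉□) (nonsquare⇒-x∈□ y∉□)
    in r , -‿injective (trans (-‿distribˡ-* x (r * r)) -xr²≈-y)

  norm-surjective : ∀ x → ∃ λ u → norm u ≈ x
  norm-surjective x with isSquare? x
  ... | yes (r , rr≈x) = (r , 0#) , trans (+-congˡ (zeroˡ 0#)) (trans (+-identityʳ (r * r)) rr≈x)
  ... | no  x∉□ =
    let a , a²+1∉□ = nonsquare-successor
        r , [a²+1]r²≈x = nonsquare-ratio a²+1∉□ x∉□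
    in (a * r , r) , trans (solve 2 (λ a r → (a :* r) :* (a :* r) :+ r :* r := (a :* a :+ con (+ 1)) :* (r :* r))
                                    refl a r) [a²+1]r²≈x

  -- In F(√−1) ≅ F², multiplication by a point of norm r maps the unit circle onto the circle of radius r.
  #circle₁≡#circle : ∀ {r} → NonZero r → Plane.# (circle? 1#) ≡ Plane.# (circle? r)
  #circle₁≡#circle {r} r≉0 with u , nu≈r ← norm-surjective r =
    PlaneMaps.#-bijection (circle? 1#) (circle-resp 1#) (u ·_) (·-congˡ u) (circle? r) (circle-resp r)
      ((r⁻¹ ⋆ conj u) ·_) (·-congˡ (r⁻¹ ⋆ conj u)) maps-to maps-from
      (λ {z} _ → Plane.trans (⋆conj·-cancel r⁻¹ u z) (Plane.trans (⋆-cong r⁻¹nu≈1 Plane.refl) (1⋆z≋z z)))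
      (λ {w} _ → Plane.trans (·⋆conj-cancel r⁻¹ u w) (Plane.trans (⋆-cong r⁻¹nu≈1 Plane.refl) (1⋆z≋z w)))
    where
    module PlaneMaps = FiniteDecSetoidMaps Plane Plane
    r⁻¹ : Carrier
    r⁻¹ = proj₁ (inverse r r≉0)
    r⁻¹r≈1 : r⁻¹ * r ≈ 1#
    r⁻¹r≈1 = trans (*-comm r⁻¹ r) (proj₂ (inverse r r≉0))
    r⁻¹nu≈1 : r⁻¹ * norm u ≈ 1#
    r⁻¹nu≈1 = trans (*-congˡ nu≈r) r⁻¹r≈1
    maps-to : ∀ {z} → Circle 1# z → Circle r (u · z)
    maps-to {z} nz≈1 = trans (norm-· u z) (trans (*-cong nu≈r nz≈1) (*-identityʳ r))
    maps-from : ∀ {w} → Circle r w → Circle 1# ((r⁻¹ ⋆ conj u) · w)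
    maps-from {w} nw≈r = begin
      norm ((r⁻¹ ⋆ conj u) · w)        ≈⟨ norm-⋆conj· r⁻¹ u w ⟩
      (r⁻¹ * r⁻¹) * (norm u * norm w)  ≈⟨ *-congˡ (*-cong nu≈r nw≈r) ⟩
      (r⁻¹ * r⁻¹) * (r * r)            ≈⟨ solve 2 (λ r⁻¹ r → (r⁻¹ :* r⁻¹) :* (r :* r) := (r⁻¹ :* r) :* (r⁻¹ :* r)) refl r⁻¹ r ⟩
      (r⁻¹ * r) * (r⁻¹ * r)            ≈⟨ *-cong r⁻¹r≈1 r⁻¹r≈1 ⟩
      1# * 1#                          ≈⟨ *-identityˡ 1# ⟩
      1#                               ∎

  #nonOrigin≡#nonZero*#circle₁ : Plane.# nonOrigin? ≡ # nonZero? ℕ.* Plane.# (circle? 1#)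
  #nonOrigin≡#nonZero*#circle₁ = NormMaps.#-fibres nonOrigin? nonOrigin-resp norm norm-cong nonZero? _ nonZero-resp
    (λ z≉0 nz≈0 → z≉0 (x*x+y*y≈0⇒x≈0 nz≈0 , x*x+y*y≈0⇒y≈0 nz≈0))
    (λ {y} y≉0 → ≡.trans (PlaneCount.#-cong _ (circle? y) (proj₂ , λ nz≈y → off-origin y≉0 nz≈y , nz≈y))
                         (≡.sym (#circle₁≡#circle y≉0)))
    where
    module NormMaps = FiniteDecSetoidMaps Plane 𝔽
    module PlaneCount = FiniteDecSetoidProperties Plane
    off-origin : ∀ {y z} → NonZero y → norm z ≈ y → ¬ z ≋ origin
    off-origin y≉0 nz≈y z≋0 = y≉0 (trans (sym nz≈y) (trans (norm-cong z≋0) norm-origin))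

  #circle : ∀ {r} → NonZero r → Plane.# (circle? r) ≡ suc size
  #circle r≉0 = ≡.trans (≡.sym (#circle₁≡#circle r≉0)) (≡.trans
    ([1+n]²≡1+n*c⇒c≡2+n (# nonZero?) _ (#-nonzero nonZero? nonZero-resp 1≉0) [1+#nonZero]²≡1+#nonZero*#circle₁)
    (≡.cong suc (≡.sym size≡1+#nonZero)))
    where
    [1+#nonZero]²≡1+#nonZero*#circle₁ :
      suc (# nonZero?) ℕ.* suc (# nonZero?) ≡ suc (# nonZero? ℕ.* Plane.# (circle? 1#))
    [1+#nonZero]²≡1+#nonZero*#circle₁ = ≡.trans (≡.cong₂ ℕ._*_ (≡.sym size≡1+#nonZero) (≡.sym size≡1+#nonZero))
      (≡.trans (≡.sym #plane≡size²) (≡.trans #plane≡1+#nonOrigin (≡.cong suc #nonOrigin≡#nonZero*#circle₁)))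

module Quadrance {c ℓ} (F : FiniteField c ℓ) where
  open FiniteField F
  open FiniteFieldProperties F
  open PlaneGeometry F
  open FiniteDecSetoid 𝔽 using (#_)
  open ℤ-CoefficientSolver cring using (solve; _:=_; _:+_; _:*_; _:-_; con)

  quadrance-sym : ∀ X Y → quadrance F X Y ≈ quadrance F Y X
  quadrance-sym (x₁ , y₁) (x₂ , y₂) = solve 4 (λ x₁ y₁ x₂ y₂ →
    (x₂ :- x₁) :* (x₂ :- x₁) :+ (y₂ :- y₁) :* (y₂ :- y₁) := (x₁ :- x₂) :* (x₁ :- x₂) :+ (y₁ :- y₂) :* (y₁ :- y₂))
    refl x₁ y₁ x₂ y₂

  quadrance-cong : ∀ {X X′ Y Y′} → X ≋ X′ → Y ≋ Y′ → quadrance F X Y ≈ quadrance F X′ Y′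
  quadrance-cong X≋X′ Y≋Y′ = norm-cong (⊖-cong Y≋Y′ X≋X′)

  ≋⇒quadrance≈0 : ∀ {X Y} → X ≋ Y → quadrance F X Y ≈ 0#
  ≋⇒quadrance≈0 {X@(x , y)} X≋Y = trans (quadrance-cong Plane.refl (Plane.sym X≋Y))
    (solve 2 (λ x y → (x :- x) :* (x :- x) :+ (y :- y) :* (y :- y) := con (+ 0)) refl x y)

  between-resp : ∀ i j α β → Between F i j α β Respects _≋_
  between-resp i j α β γ≋γ′ (αγ∈Cᵢ , γβ∈Cⱼ) = trans (quadrance-cong Plane.refl (Plane.sym γ≋γ′)) αγ∈Cᵢ
                                             , trans (quadrance-cong (Plane.sym γ≋γ′) Plane.refl) γβ∈Cⱼ

  interCount≡#between : ∀ i j α β → interCount F i j α β ≡ Plane.# (Between? F i j α β)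
  interCount≡#between i j α β = ≡.sym (count-cartesianProduct-tabulate (Between? F i j α β) enum enum)

  #circle-around≡#circle : ∀ α r → Plane.# (λ γ → quadrance F α γ ≟ r) ≡ Plane.# (circle? r)
  #circle-around≡#circle α r = #-bijection (λ γ → quadrance F α γ ≟ r) (λ γ≋γ′ → circle-resp r (⊖-cong γ≋γ′ Plane.refl))
    (_⊖ α) (λ γ≋γ′ → ⊖-cong γ≋γ′ Plane.refl) (circle? r) (circle-resp r) (α ⊕_) (⊕-cong Plane.refl) id
    (λ {w} w∈Cᵣ → trans (norm-cong (⊕⊖-cancel α w)) w∈Cᵣ) (λ {γ} _ → ⊕⊖-inverse α γ) (λ {w} _ → ⊕⊖-cancel α w)
    where open FiniteDecSetoidMaps Plane Plane using (#-bijection)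

  module OffDiagonal (quarter : Carrier) (4q≈1 : four F * quarter ≈ 1#) {i j k : Carrier} {α β : Point F}
                     (αβ∈Cₖ : InClass F k α β) (k≉0 : NonZero k) where
    open FiniteDecSetoidMaps Plane 𝔽 using (#-bijection)
    private
      module ≈-Reasoning = Relation.Binary.Reasoning.Setoid setoid

    u : Point F
    u = β ⊖ α

    half : Carrier
    half = (1# + 1#) * quarter

    2*half≈1 : (1# + 1#) * half ≈ 1#
    2*half≈1 = trans (solve 1 (λ q → con (+ 2) :* (con (+ 2) :* q) := con (+ 4) :* q) refl quarter) 4q≈1

    -- The value of ⟨γ − α, u⟩ forced by the law of cosines on every γ with Q(α,γ) = i and Q(γ,β) = j.
    dot₀ : Carrier
    dot₀ = half * ((i + k) - j)

    2dot₀≈i+k-j : (1# + 1#) * dot₀ ≈ (i + k) - j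
    2dot₀≈i+k-j = trans (sym (*-assoc _ half _)) (trans (*-congʳ 2*half≈1) (*-identityˡ _))

    D : Carrier
    D = fijk F quarter i j k

    dot₀²+D≈ik : dot₀ * dot₀ + D ≈ i * k
    dot₀²+D≈ik = begin
      dot₀ * dot₀ + D
        ≈⟨ solve 4 (λ q i j k →
             (con (+ 2) :* q :* ((i :+ k) :- j)) :* (con (+ 2) :* q :* ((i :+ k) :- j))
               :+ (i :* j :- ((k :- i) :- j) :* ((k :- i) :- j) :* q)
             := i :* k :+ (con (+ 4) :* q :- con (+ 1)) :* (q :* (((i :+ k) :- j) :* ((i :+ k) :- j)) :+ i :* (k :- j)))
             refl quarter i j k ⟩
      i * k + (four F * quarter - 1#) * (quarter * (((i + k) - j) * ((i + k) - j)) + i * (k - j))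
        ≈⟨ +-congˡ (trans (*-congʳ (trans (+-congʳ 4q≈1) (-‿inverseʳ 1#))) (zeroˡ _)) ⟩
      i * k + 0#
        ≈⟨ +-identityʳ (i * k) ⟩
      i * k
        ∎
      where open ≈-Reasoning

    k⁻¹ : Carrier
    k⁻¹ = proj₁ (inverse k k≉0)

    k⁻¹-cancel : ∀ x → k⁻¹ * (x * norm u) ≈ x
    k⁻¹-cancel x = begin
      k⁻¹ * (x * norm u)  ≈⟨ *-congˡ (*-congˡ αβ∈Cₖ) ⟩
      k⁻¹ * (x * k)       ≈⟨ solve 3 (λ k⁻¹ x k → k⁻¹ :* (x :* k) := x :* (k :* k⁻¹)) refl k⁻¹ x k ⟩
      x * (k * k⁻¹)       ≈⟨ *-congˡ (proj₂ (inverse k k≉0)) ⟩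
      x * 1#              ≈⟨ *-identityʳ x ⟩
      x                   ∎
      where open ≈-Reasoning

    dot-between : ∀ {γ} → Between F i j α β γ → (γ ⊖ α) ∙ u ≈ dot₀
    dot-between {γ} (αγ∈Cᵢ , γβ∈Cⱼ) = begin
      x                                 ≈⟨ *-identityˡ x ⟨
      1# * x                            ≈⟨ *-congʳ 2*half≈1 ⟨
      ((1# + 1#) * half) * x            ≈⟨ solve 3 (λ h x s → (con (+ 2) :* h) :* x := h :* (s :- (s :- con (+ 2) :* x)))
                                                   refl half x s ⟩
      half * (s - (s - (1# + 1#) * x))  ≈⟨ *-congˡ (+-cong (+-cong αγ∈Cᵢ αβ∈Cₖ)
                                                           (-‿cong (trans (sym (law-of-cosines α β γ)) γβ∈Cⱼ))) ⟩
      dot₀                              ∎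
      where
      open ≈-Reasoning
      x s : Carrier
      x = (γ ⊖ α) ∙ u
      s = quadrance F α γ + quadrance F α β

    cross : Point F → Carrier
    cross γ = (γ ⊖ α) ∧ u

    cross-cong : Congruent _≋_ _≈_ cross
    cross-cong γ≋γ′ = ∧-congʳ u (⊖-cong γ≋γ′ Plane.refl)

    cross²-between : ∀ {γ} → Between F i j α β γ → cross γ * cross γ ≈ D
    cross²-between {γ} γ∈B@(αγ∈Cᵢ , _) = begin
      cross γ * cross γ                    ≈⟨ solve 2 (λ x y → y :* y := (x :* x :+ y :* y) :- x :* x) refl x (cross γ) ⟩
      (x * x + cross γ * cross γ) - x * x  ≈⟨ +-cong (trans (lagrange (γ ⊖ α) u) (*-cong αγ∈Cᵢ αβ∈Cₖ))
                                                     (-‿cong (square-cong (dot-between γ∈B))) ⟩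
      i * k - dot₀ * dot₀                  ≈⟨ +-congʳ dot₀²+D≈ik ⟨
      (dot₀ * dot₀ + D) - dot₀ * dot₀      ≈⟨ solve 2 (λ x d → (x :+ d) :- x := d) refl (dot₀ * dot₀) D ⟩
      D                                    ∎
      where
      open ≈-Reasoning
      x : Carrier
      x = (γ ⊖ α) ∙ u

    lift : Carrier → Point F
    lift b = α ⊕ (k⁻¹ ⋆ ((dot₀ ⋆ u) ⊕ (b ⋆ rot u)))

    lift-cong : Congruent _≈_ _≋_ lift
    lift-cong b≈b′ = ⊕-cong Plane.refl (⋆-cong refl (⊕-cong Plane.refl (⋆-cong b≈b′ Plane.refl)))

    lift⊖α : ∀ b → lift b ⊖ α ≋ k⁻¹ ⋆ ((dot₀ ⋆ u) ⊕ (b ⋆ rot u))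
    lift⊖α b = ⊕⊖-cancel α _

    cross-lift : ∀ b → cross (lift b) ≈ b
    cross-lift b = trans (∧-congʳ u (lift⊖α b)) (trans (frame-∧ k⁻¹ dot₀ b u) (k⁻¹-cancel b))

    lift-between : ∀ {b} → b * b ≈ D → Between F i j α β (lift b)
    lift-between {b} bb≈D = αγ∈Cᵢ , γβ∈Cⱼ
      where
      open ≈-Reasoning
      αγ∈Cᵢ : quadrance F α (lift b) ≈ i
      αγ∈Cᵢ = begin
        norm (lift b ⊖ α)                               ≈⟨ norm-cong (lift⊖α b) ⟩
        norm (k⁻¹ ⋆ ((dot₀ ⋆ u) ⊕ (b ⋆ rot u)))         ≈⟨ frame-norm k⁻¹ dot₀ b u ⟩
        (k⁻¹ * k⁻¹) * ((dot₀ * dot₀ + b * b) * norm u)  ≈⟨ *-congˡ (*-congʳ (trans (+-congˡ bb≈D) dot₀²+D≈ik)) ⟩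
        (k⁻¹ * k⁻¹) * ((i * k) * norm u)                ≈⟨ solve 4 (λ k⁻¹ i k n → (k⁻¹ :* k⁻¹) :* ((i :* k) :* n)
                                                                     := k⁻¹ :* ((k⁻¹ :* (i :* n)) :* k)) refl k⁻¹ i k (norm u) ⟩
        k⁻¹ * ((k⁻¹ * (i * norm u)) * k)                ≈⟨ *-congˡ (*-congʳ (k⁻¹-cancel i)) ⟩
        k⁻¹ * (i * k)                                   ≈⟨ *-congˡ (*-congˡ αβ∈Cₖ) ⟨
        k⁻¹ * (i * norm u)                              ≈⟨ k⁻¹-cancel i ⟩
        i                                               ∎
      dot≈dot₀ : (lift b ⊖ α) ∙ u ≈ dot₀
      dot≈dot₀ = trans (∙-congʳ u (lift⊖α b)) (trans (frame-∙ k⁻¹ dot₀ b u) (k⁻¹-cancel dot₀))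
      γβ∈Cⱼ : quadrance F (lift b) β ≈ j
      γβ∈Cⱼ = begin
        quadrance F (lift b) β
          ≈⟨ law-of-cosines α β (lift b) ⟩
        (quadrance F α (lift b) + quadrance F α β) - (1# + 1#) * ((lift b ⊖ α) ∙ u)
          ≈⟨ +-cong (+-cong αγ∈Cᵢ αβ∈Cₖ) (-‿cong (trans (*-congˡ dot≈dot₀) 2dot₀≈i+k-j)) ⟩
        (i + k) - ((i + k) - j)
          ≈⟨ solve 3 (λ i j k → (i :+ k) :- ((i :+ k) :- j) := j) refl i j k ⟩
        j
          ∎

    lift-cross : ∀ {γ} → Between F i j α β γ → lift (cross γ) ≋ γ
    lift-cross {γ} γ∈B = begin
      α ⊕ (k⁻¹ ⋆ ((dot₀ ⋆ u) ⊕ (cross γ ⋆ rot u)))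
        ≈⟨ ⊕-cong Plane.refl (⋆-cong refl (⊕-cong (⋆-cong (dot-between γ∈B) Plane.refl) Plane.refl)) ⟨
      α ⊕ (k⁻¹ ⋆ ((((γ ⊖ α) ∙ u) ⋆ u) ⊕ (cross γ ⋆ rot u)))
        ≈⟨ ⊕-cong Plane.refl (⋆-cong refl (frame-decomposition (γ ⊖ α) u)) ⟨
      α ⊕ (k⁻¹ ⋆ (norm u ⋆ (γ ⊖ α)))
        ≈⟨ ⊕-cong Plane.refl (⋆-assoc k⁻¹ (norm u) (γ ⊖ α)) ⟩
      α ⊕ ((k⁻¹ * norm u) ⋆ (γ ⊖ α))
        ≈⟨ ⊕-cong Plane.refl (⋆-cong (trans (*-congˡ (sym (*-identityˡ (norm u)))) (k⁻¹-cancel 1#)) Plane.refl) ⟩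
      α ⊕ (1# ⋆ (γ ⊖ α))
        ≈⟨ ⊕-cong Plane.refl (1⋆z≋z (γ ⊖ α)) ⟩
      α ⊕ (γ ⊖ α)
        ≈⟨ ⊕⊖-inverse α γ ⟩
      γ
        ∎
      where open import Relation.Binary.Reasoning.Setoid Plane.setoid

    interCount≡#roots : interCount F i j α β ≡ # (roots? D)
    interCount≡#roots = ≡.trans (interCount≡#between i j α β)
      (#-bijection (Between? F i j α β) (between-resp i j α β) cross cross-cong (roots? D) (roots-resp D)
                   lift lift-cong cross²-between lift-between lift-cross (λ {b} _ → cross-lift b))

module QuadranceScheme {c ℓ} (F : FiniteField c ℓ) (-1∉□ : ¬ IsSquare F (FiniteField.-_ F (FiniteField.1# F))) where
  open FiniteField F
  open FiniteFieldProperties F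
  open PlaneGeometry F
  open MinusOneNonSquare F -1∉□
  open Quadrance F
  open FiniteDecSetoid 𝔽 using (#_)
  open FiniteDecSetoidProperties Plane using (#-none; #-singleton; #-cong)
  open import Algebra.Properties.Ring ring using (x∙y⁻¹≈ε⇒x≈y)
  open ℤ-CoefficientSolver cring using (solve; _:=_; _:*_; con)

  quadrance≈0⇒≋ : ∀ {X Y} → quadrance F X Y ≈ 0# → X ≋ Y
  quadrance≈0⇒≋ {x₁ , y₁} {x₂ , y₂} XY∈C₀ =
    sym (x∙y⁻¹≈ε⇒x≈y x₂ x₁ (x*x+y*y≈0⇒x≈0 XY∈C₀)) , sym (x∙y⁻¹≈ε⇒x≈y y₂ y₁ (x*x+y*y≈0⇒y≈0 XY∈C₀))

  module Diagonal {α β : Point F} (αβ∈C₀ : InClass F 0# α β) where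

    α≋β : α ≋ β
    α≋β = quadrance≈0⇒≋ αβ∈C₀

    quadrance-γβ≈αγ : ∀ γ → quadrance F γ β ≈ quadrance F α γ
    quadrance-γβ≈αγ γ = trans (quadrance-cong Plane.refl (Plane.sym α≋β)) (quadrance-sym γ α)

    interCount-≉ : ∀ {i j} → ¬ i ≈ j → interCount F i j α β ≡ 0
    interCount-≉ {i} {j} i≉j = ≡.trans (interCount≡#between i j α β)
      (#-none _ λ γ (αγ∈Cᵢ , γβ∈Cⱼ) → i≉j (trans (sym αγ∈Cᵢ) (trans (sym (quadrance-γβ≈αγ γ)) γβ∈Cⱼ)))

    interCount-0 : ∀ {i j} → i ≈ 0# → j ≈ 0# → interCount F i j α β ≡ 1
    interCount-0 {i} {j} i≈0 j≈0 = ≡.trans (interCount≡#between i j α β) (#-singleton _ α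
      ( (λ (αγ∈Cᵢ , _) → Plane.sym (quadrance≈0⇒≋ (trans αγ∈Cᵢ i≈0)))
      , (λ γ≋α → trans (≋⇒quadrance≈0 (Plane.sym γ≋α)) (sym i≈0)
               , trans (≋⇒quadrance≈0 (Plane.trans γ≋α α≋β)) (sym j≈0))))

    interCount-circle : ∀ {i j} → i ≈ j → NonZero i → interCount F i j α β ≡ suc size
    interCount-circle {i} {j} i≈j i≉0 = begin
      interCount F i j α β                 ≡⟨ interCount≡#between i j α β ⟩
      Plane.# (Between? F i j α β)         ≡⟨ #-cong _ _ (proj₁ , λ {γ} αγ∈Cᵢ →
                                                αγ∈Cᵢ , trans (quadrance-γβ≈αγ γ) (trans αγ∈Cᵢ i≈j)) ⟩
      Plane.# (λ γ → quadrance F α γ ≟ i)  ≡⟨ #circle-around≡#circle α i ⟩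
      Plane.# (circle? i)                  ≡⟨ #circle i≉0 ⟩
      suc size                             ∎
      where open ≡.≡-Reasoning

  4≉0 : NonZero (four F)
  4≉0 4≈0 = 1+1≉0 ([ id , id ]′ (x*y≈0⇒x≈0∨y≈0 (trans (solve 0 (con (+ 2) :* con (+ 2) := con (+ 4)) refl) 4≈0)))

  ¼ : Carrier
  ¼ = proj₁ (inverse (four F) 4≉0)

  intersectionNumber : Carrier → Carrier → Carrier → ℕ
  intersectionNumber i j k with k ≟ 0#
  ... | no  _ = # (roots? (fijk F ¼ i j k))
  ... | yes _ with i ≟ j | i ≟ 0#
  ...   | no  _ | _     = 0
  ...   | yes _ | yes _ = 1
  ...   | yes _ | no  _ = suc size

  interCount≡intersectionNumber : ∀ i j k α β → InClass F k α β → interCount F i j α β ≡ intersectionNumber i j k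
  interCount≡intersectionNumber i j k α β αβ∈Cₖ with k ≟ 0#
  ... | no  k≉0 = OffDiagonal.interCount≡#roots ¼ (proj₂ (inverse (four F) 4≉0)) αβ∈Cₖ k≉0
  ... | yes k≈0 with i ≟ j | i ≟ 0#
  ...   | no  i≉j | _       = Diagonal.interCount-≉ (trans αβ∈Cₖ k≈0) i≉j
  ...   | yes i≈j | yes i≈0 = Diagonal.interCount-0 (trans αβ∈Cₖ k≈0) i≈0 (trans (sym i≈j) i≈0)
  ...   | yes i≈j | no  i≉0 = Diagonal.interCount-circle (trans αβ∈Cₖ k≈0) i≈j i≉0

  isQuadranceScheme : IsQuadranceScheme F
  isQuadranceScheme = record
    { diagonal     = λ X Y → mk⇔ quadrance≈0⇒≋ ≋⇒quadrance≈0
    ; symmetric    = λ i X Y XY∈Cᵢ → trans (quadrance-sym Y X) XY∈Cᵢ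
    ; intersection = intersectionNumber , interCount≡intersectionNumber
    }

  hasIntersectionNumbers : ∀ quarter → four F * quarter ≈ 1# → HasIntersectionNumbers F quarter
  hasIntersectionNumbers quarter 4q≈1 = record
    { p0-ne      = λ i j α β αβ∈C₀ i≉j → Diagonal.interCount-≉ αβ∈C₀ i≉j
    ; p0-zero    = λ i j α β αβ∈C₀ i≈0 j≈0 → Diagonal.interCount-0 αβ∈C₀ i≈0 j≈0
    ; p0-nonzero = λ i j α β αβ∈C₀ i≈j i≉0 → ≡.trans (Diagonal.interCount-circle αβ∈C₀ i≈j i≉0) (ℕₚ.+-comm 1 size)
    ; pk-nonsq   = λ i j k α β αβ∈Cₖ k≉0 D∉□ → ≡.trans (#between αβ∈Cₖ k≉0) (#roots-nonsquare D∉□)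
    ; pk-zero    = λ i j k α β αβ∈Cₖ k≉0 D≈0 → ≡.trans (#between αβ∈Cₖ k≉0) (#roots-zero D≈0)
    ; pk-sq      = λ i j k α β αβ∈Cₖ k≉0 D≉0 D∈□ → ≡.trans (#between αβ∈Cₖ k≉0) (#roots-square 1+1≉0 D≉0 D∈□)
    }
    where
    #between : ∀ {i j k α β} → InClass F k α β → NonZero k → interCount F i j α β ≡ # (roots? (fijk F quarter i j k))
    #between = OffDiagonal.interCount≡#roots quarter 4q≈1

theorem2 : {c ℓ : Level} (F : FiniteField c ℓ) →
  FiniteField.size F % 4 ≡ 3 →
  IsQuadranceScheme F ×
    (∀ quarter → FiniteField._≈_ F (FiniteField._*_ F (four F) quarter) (FiniteField.1# F) →
      HasIntersectionNumbers F quarter)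
theorem2 F size≡3 = isQuadranceScheme , hasIntersectionNumbers
  where open QuadranceScheme F (FiniteFieldProperties.3mod4⇒-1∉□ F size≡3)
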